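{- Let $\sigma$ be a separable permutation with $\mathrm{sh}(\sigma)=\lambda=(\lambda_1,\lambda_2,\dots)$. Let $k\ge 0$ and let $s^1,\dots,s^k$ be pairwise disjoint (possibly empty) increasing subsequences of $\sigma$. Then there exists an increasing subsequence $u^{k+1}$ of $\sigma$, disjoint from each $s^i$, such that $|u^{k+1}|\ge \lambda_{k+1}$.
   Context: A permutation is separable if it contains neither of the patterns $3142$ and $2413$ (a permutation $\tau$ contains $\pi\in S_m$ if some length-$m$ subsequence of $\tau$ is in the same relative order as $\pi$). Subsequences are identified with sets of positions; $|u|$ is the length of $u$. The shape $\mathrm{sh}(\sigma)$ is the shape of the insertion tableau of $\sigma$ under the Robinson–Schensted(–Knuth) correspondence via row insertion; partitions have weakly decreasing parts, padded with zeros. -}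

module Defs where

open import Data.Nat as ℕ using (ℕ; zero; suc; _<?_)
open import Data.Fin as Fin using (Fin; toℕ; #_)
open import Data.Fin.Subset using (Subset; _∈_)
open import Data.Vec using (Vec; []; _∷_; lookup)
open import Data.List as List using (List; []; _∷_; [_]; foldl; tabulate; map; length)
open import Data.Maybe using (Maybe; just; nothing)
open import Data.Product using (_×_; _,_; ∃-syntax; Σ-syntax)
open import Data.Empty using (⊥)
open import Relation.Nullary using (¬_; yes; no)
open import Function using (_∘_)

-- Permutations of [n] are represented as functions Fin n → Fin n
-- (injectivity is imposed separately in the statement).

Contains : ∀ {n m} → (Fin n → Fin n) → (Fin m → Fin m) → Set
Contains {n} {m} τ π =
  Σ[ f ∈ (Fin m → Fin n) ] ((∀ a b → a Fin.< b → f a Fin.< f b)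
         × (∀ a b → (π a Fin.< π b → τ (f a) Fin.< τ (f b))
                  × (τ (f a) Fin.< τ (f b) → π a Fin.< π b)))

-- 0-based versions of 3142 and 2413
p3142 : Fin 4 → Fin 4
p3142 = lookup (# 2 ∷ # 0 ∷ # 3 ∷ # 1 ∷ [])

p2413 : Fin 4 → Fin 4
p2413 = lookup (# 1 ∷ # 3 ∷ # 0 ∷ # 2 ∷ [])

Separable : ∀ {n} → (Fin n → Fin n) → Set
Separable σ = ¬ Contains σ p3142 × ¬ Contains σ p2413

-- Subsequences = sets of positions
Increasing : ∀ {n} → (Fin n → Fin n) → Subset n → Set
Increasing σ s = ∀ i j → i ∈ s → j ∈ s → i Fin.< j → σ i Fin.< σ j

Disjoint : ∀ {n} → Subset n → Subset n → Set
Disjoint p q = ∀ x → x ∈ p → x ∈ q → ⊥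

insRow : ℕ → List ℕ → Maybe ℕ × List ℕ
insRow x [] = nothing , [ x ]
insRow x (y ∷ ys) with x <? y
... | yes _ = just y , (x ∷ ys)
... | no _ with insRow x ys
...   | (b , r) = b , (y ∷ r)

insTab : ℕ → List (List ℕ) → List (List ℕ)
insTab x [] = [ [ x ] ]
insTab x (r ∷ rs) with insRow x r
... | (nothing , r') = r' ∷ rs
... | (just y , r') = r' ∷ insTab y rs

insertionTableau : ∀ {n} → (Fin n → Fin n) → List (List ℕ)
insertionTableau {n} σ = foldl (λ T x → insTab x T) [] (tabulate (toℕ ∘ σ))

shape : ∀ {n} → (Fin n → Fin n) → List ℕ
shape σ = map length (insertionTableau σ)

-- k-th part (0-indexed), padded with zeros
part : List ℕ → ℕ → ℕ
part [] _ = 0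
part (x ∷ _) zero = x
part (_ ∷ xs) (suc k) = part xs k

module Submission where

-- Read σ as the word w = σ(0) σ(1) … σ(n-1) of distinct naturals and a subset
-- of positions as a Boolean mask on w.  The argument follows the recursive
-- structure of separable permutations:
--
--  * Decomposition: a word of distinct letters avoiding 3142 and 2413 is a
--    singleton, or a direct sum A ⊕ B (every letter of A below every letter
--    of B) or a skew sum A ⊖ B (every letter of A above every letter of B) of
--    two shorter such words.
--  * Shapes of sums (Robinson–Schensted):  P(A ⊕ B) is P(A) with the rows of
--    P(B) appended row by row, so λₖ(A ⊕ B) = λₖ(A) + λₖ(B);  P(A ⊖ B) is
--    obtained by stacking P(B) on top of the columns of P(A), so
--    λ_{k₁+k₂}(A ⊖ B) ≤ max (λ_{k₁}(A)) (λ_{k₂}(B)).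
--  * Main induction over the decomposition: for a direct sum, restrict the k
--    given masks to both halves and concatenate the two answers; for a skew
--    sum, every increasing mask lives entirely in one half, so the masks split
--    into k₁ masks of A and k₂ masks of B, and the better half's answer wins.

open import Defs
open import Data.Nat using (ℕ; _≤_)
open import Data.Fin using (Fin)
open import Data.Fin.Subset using (Subset; ∣_∣)
open import Data.Product using (_×_; ∃-syntax)
open import Relation.Binary.PropositionalEquality using (_≡_; _≢_)
open import Function.Definitions using (Injective)

module RowInsertion where

  open import Data.Nat
  open import Data.Nat.Properties
  open import Data.List using (List; []; _∷_; _++_)
  open import Data.Maybe using (Maybe; just; nothing)
  open import Data.Product using (_×_; _,_; ∃-syntax; proj₂)
  open import Data.Sum using (_⊎_; inj₁; inj₂)
  open import Data.Empty using (⊥-elim)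
  open import Relation.Nullary using (yes; no)
  open import Relation.Binary.PropositionalEquality

  -- Tableaux as lists of rows, the top row first.
  Tableau : Set
  Tableau = List (List ℕ)

  entry : List ℕ → ℕ → Maybe ℕ
  entry [] _ = nothing
  entry (x ∷ r) zero = just x
  entry (x ∷ r) (suc q) = entry r q

  replace : List ℕ → ℕ → ℕ → List ℕ
  replace [] _ _ = []
  replace (y ∷ r) zero x = x ∷ r
  replace (y ∷ r) (suc c) x = y ∷ replace r c x

  Below : ℕ → List ℕ → ℕ → Set
  Below x r c = ∀ q a → q < c → entry r q ≡ just a → a ≤ x

  AllBelow : ℕ → List ℕ → Set
  AllBelow x r = ∀ q a → entry r q ≡ just a → a ≤ x

  insRow-append : ∀ x r → AllBelow x r → insRow x r ≡ (nothing , r ++ x ∷ [])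
  insRow-append x [] h = refl
  insRow-append x (y ∷ r) h with x <? y
  ... | yes p = ⊥-elim (<⇒≱ p (h 0 y refl))
  ... | no _ rewrite insRow-append x r (λ q → h (suc q)) = refl

  insRow-bump : ∀ x r c e → Below x r c → entry r c ≡ just e → x < e →
    insRow x r ≡ (just e , replace r c x)
  insRow-bump x [] c e h () lt
  insRow-bump x (y ∷ r) zero e h refl lt with x <? y
  ... | yes _ = refl
  ... | no ¬p = ⊥-elim (¬p lt)
  insRow-bump x (y ∷ r) (suc c) e h eq lt with x <? y
  ... | yes p = ⊥-elim (<⇒≱ p (h 0 y (s≤s z≤n) refl))
  ... | no _ rewrite insRow-bump x r c e (λ q a q<c → h (suc q) a (s≤s q<c)) eq lt = refl

  data Ins (x : ℕ) : Tableau → Tableau → Set where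
    new : Ins x [] ((x ∷ []) ∷ [])
    app : ∀ {r T} → AllBelow x r → Ins x (r ∷ T) ((r ++ x ∷ []) ∷ T)
    bump : ∀ {r T T'} c {e} → Below x r c → entry r c ≡ just e → x < e →
           Ins e T T' → Ins x (r ∷ T) (replace r c x ∷ T')

  ins-sound : ∀ {x T T'} → Ins x T T' → insTab x T ≡ T'
  ins-sound new = refl
  ins-sound {x} (app {r} h) rewrite insRow-append x r h = refl
  ins-sound {x} (bump {r} c {e} h eq lt I) rewrite insRow-bump x r c e h eq lt | ins-sound I = refl

  RowView : ℕ → List ℕ → Set
  RowView x r = AllBelow x r ⊎ (∃[ c ] ∃[ e ] (Below x r c × entry r c ≡ just e × x < e))

  rowView : ∀ x r → RowView x r
  rowView x [] = inj₁ (λ q a ())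
  rowView x (y ∷ r) with x <? y
  ... | yes p = inj₂ (0 , y , (λ { q a () }) , refl , p)
  ... | no ¬p with rowView x r
  ...   | inj₁ h = inj₁ λ { zero a refl → ≮⇒≥ ¬p ; (suc q) a e → h q a e }
  ...   | inj₂ (c , e , h , eq , lt) =
          inj₂ (suc c , e , (λ { zero a _ refl → ≮⇒≥ ¬p ; (suc q) a (s≤s q<c) e → h q a q<c e }) , eq , lt)

  ins-exists : ∀ x T → ∃[ T' ] Ins x T T'
  ins-exists x [] = _ , new
  ins-exists x (r ∷ T) with rowView x r
  ... | inj₁ h = _ , app h
  ... | inj₂ (c , e , h , eq , lt) = _ , bump c h eq lt (proj₂ (ins-exists e T))

  ins-insTab : ∀ x T → Ins x T (insTab x T)
  ins-insTab x T with ins-exists x T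
  ... | T' , I = subst (Ins x T) (sym (ins-sound I)) I

module TableauInvariant where

  open RowInsertion
  open import Data.Nat
  open import Data.Nat.Properties
  open import Data.List using (List; []; _∷_; _++_; length)
  open import Data.Maybe using (Maybe; just; nothing)
  open import Data.Maybe.Properties using (just-injective)
  open import Data.Product using (_×_; _,_; ∃-syntax)
  open import Data.Sum using (inj₁; inj₂)
  open import Data.Unit using (⊤; tt)
  open import Data.Empty using (⊥-elim)
  open import Relation.Nullary using (yes; no)
  open import Relation.Binary.PropositionalEquality

  entry-lt : ∀ r q {a} → entry r q ≡ just a → q < length r
  entry-lt (x ∷ r) zero eq = s≤s z≤n
  entry-lt (x ∷ r) (suc q) eq = s≤s (entry-lt r q eq)

  lt-entry : ∀ r q → q < length r → ∃[ a ] entry r q ≡ just a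
  lt-entry (x ∷ r) zero _ = x , refl
  lt-entry (x ∷ r) (suc q) (s≤s lt) = lt-entry r q lt

  entry-none : ∀ r q → entry r q ≡ nothing → length r ≤ q
  entry-none [] q _ = z≤n
  entry-none (x ∷ r) zero ()
  entry-none (x ∷ r) (suc q) eq = s≤s (entry-none r q eq)

  none-entry : ∀ r q → length r ≤ q → entry r q ≡ nothing
  none-entry [] q _ = refl
  none-entry (x ∷ r) zero ()
  none-entry (x ∷ r) (suc q) (s≤s le) = none-entry r q le

  entry-prefix : ∀ r {q q' b} → q ≤ q' → entry r q' ≡ just b → ∃[ a ] entry r q ≡ just a
  entry-prefix r {q} {q'} le eq = lt-entry r q (≤-<-trans le (entry-lt r q' eq))

  length-exact : ∀ r c → (∀ j → j < c → ∃[ a ] entry r j ≡ just a) → entry r c ≡ nothing → length r ≡ c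
  length-exact r zero h en = n≤0⇒n≡0 (entry-none r 0 en)
  length-exact r (suc c) h en with h c ≤-refl
  ... | a , ea = ≤-antisym (entry-none r (suc c) en) (entry-lt r c ea)

  entry-replace-same : ∀ r c x {e} → entry r c ≡ just e → entry (replace r c x) c ≡ just x
  entry-replace-same (y ∷ r) zero x eq = refl
  entry-replace-same (y ∷ r) (suc c) x eq = entry-replace-same r c x eq

  entry-replace-other : ∀ r c x q → q ≢ c → entry (replace r c x) q ≡ entry r q
  entry-replace-other [] c x q ne = refl
  entry-replace-other (y ∷ r) zero x zero ne = ⊥-elim (ne refl)
  entry-replace-other (y ∷ r) zero x (suc q) ne = refl
  entry-replace-other (y ∷ r) (suc c) x zero ne = refl
  entry-replace-other (y ∷ r) (suc c) x (suc q) ne = entry-replace-other r c x q (λ e → ne (cong suc e))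

  entry-snoc-last : ∀ r x → entry (r ++ x ∷ []) (length r) ≡ just x
  entry-snoc-last [] x = refl
  entry-snoc-last (y ∷ r) x = entry-snoc-last r x

  entry-snoc-other : ∀ r x q → q ≢ length r → entry (r ++ x ∷ []) q ≡ entry r q
  entry-snoc-other [] x zero ne = ⊥-elim (ne refl)
  entry-snoc-other [] x (suc q) ne = refl
  entry-snoc-other (y ∷ r) x zero ne = refl
  entry-snoc-other (y ∷ r) x (suc q) ne = entry-snoc-other r x q (λ e → ne (cong suc e))

  entry-snoc-keep : ∀ r x {j a} → entry r j ≡ just a → entry (r ++ x ∷ []) j ≡ just a
  entry-snoc-keep r x {j} eq = trans (entry-snoc-other r x j (λ e → <-irrefl e (entry-lt r j eq))) eq

  length-replace : ∀ r c x → length (replace r c x) ≡ length r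
  length-replace [] c x = refl
  length-replace (y ∷ r) zero x = refl
  length-replace (y ∷ r) (suc c) x = cong suc (length-replace r c x)

  length-snoc : ∀ (r : List ℕ) y → length (r ++ y ∷ []) ≡ suc (length r)
  length-snoc [] y = refl
  length-snoc (x ∷ r) y = cong suc (length-snoc r y)

  WeakRow : List ℕ → Set
  WeakRow r = ∀ q a b → entry r q ≡ just a → entry r (suc q) ≡ just b → a ≤ b

  weakRow-mono : ∀ r → WeakRow r → ∀ {q q' a b} → q ≤ q' → entry r q ≡ just a → entry r q' ≡ just b → a ≤ b
  weakRow-mono r w {q} {zero} {a} {b} z≤n ea eb = ≤-reflexive (just-injective (trans (sym ea) eb))
  weakRow-mono r w {q} {suc q'} {a} {b} le ea eb with m≤n⇒m<n∨m≡n le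
  ... | inj₂ refl = ≤-reflexive (just-injective (trans (sym ea) eb))
  ... | inj₁ (s≤s lt) with entry-prefix r (n≤1+n q') eb
  ...   | m , em = ≤-trans (weakRow-mono r w lt ea em) (w q' m b em eb)

  Dominates : List ℕ → List ℕ → Set
  Dominates r r' = ∀ j b → entry r' j ≡ just b → ∃[ a ] (entry r j ≡ just a × a < b)

  DominatesNext : List ℕ → Tableau → Set
  DominatesNext r [] = ⊤
  DominatesNext r (r' ∷ _) = Dominates r r'

  NonEmpty : List ℕ → Set
  NonEmpty r = ∃[ a ] entry r 0 ≡ just a

  IsTableau : Tableau → Set
  IsTableau [] = ⊤
  IsTableau (r ∷ T) = WeakRow r × NonEmpty r × DominatesNext r T × IsTableau T

  weakRow-replace : ∀ {r c x e} → WeakRow r → Below x r c → entry r c ≡ just e → x < e → WeakRow (replace r c x)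
  weakRow-replace {r} {c} {x} {e} w h ec lt q a b ea eb with q ≟ c
  ... | yes refl rewrite entry-replace-same r c x ec | entry-replace-other r c x (suc q) 1+n≢n =
        subst (_≤ b) (just-injective ea) (≤-trans (<⇒≤ lt) (w c e b ec eb))
  ... | no q≢c with suc q ≟ c
  ...   | yes refl rewrite entry-replace-other r (suc q) x q q≢c =
          subst (a ≤_) (just-injective (trans (sym (entry-replace-same r (suc q) x ec)) eb)) (h q a (n<1+n q) ea)
  ...   | no sq≢c rewrite entry-replace-other r c x q q≢c | entry-replace-other r c x (suc q) sq≢c = w q a b ea eb

  weakRow-snoc : ∀ {r x} → WeakRow r → AllBelow x r → WeakRow (r ++ x ∷ [])
  weakRow-snoc {r} {x} w h q a b ea eb with suc q ≟ length r
  ... | yes e rewrite entry-snoc-other r x q (λ z → 1+n≢n (trans e (sym z))) | e | entry-snoc-last r x =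
        subst (a ≤_) (just-injective eb) (h q a ea)
  ... | no ne with q ≟ length r
  ...   | yes refl rewrite entry-snoc-other r x (suc (length r)) ne | none-entry r (suc (length r)) (n≤1+n _) with eb
  ...     | ()
  weakRow-snoc {r} {x} w h q a b ea eb | no ne | no ne' rewrite entry-snoc-other r x q ne' | entry-snoc-other r x (suc q) ne = w q a b ea eb

  nonEmpty-replace : ∀ {r} c x → NonEmpty r → NonEmpty (replace r c x)
  nonEmpty-replace {y ∷ r} zero x _ = x , refl
  nonEmpty-replace {y ∷ r} (suc c) x _ = y , refl

  nonEmpty-snoc : ∀ r x → NonEmpty (r ++ x ∷ [])
  nonEmpty-snoc [] x = x , refl
  nonEmpty-snoc (y ∷ r) x = y , refl

  -- When x bumps e out of the top row r₀ at column c, the new top row still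
  -- dominates the row into which e is inserted: e lands in a column ≤ c.
  dominates-bump : ∀ {r0 c x e T1 T1'} → WeakRow r0 → Below x r0 c → entry r0 c ≡ just e → x < e →
           DominatesNext r0 T1 → Ins e T1 T1' → DominatesNext (replace r0 c x) T1'
  dominates-bump {r0} {c} {x} {e} w h ec lt dh I = go I dh
    where
    belowE : ∀ j → j ≤ c → ∃[ a ] (entry (replace r0 c x) j ≡ just a × a < e)
    belowE j le with j ≟ c
    ... | yes refl = x , entry-replace-same r0 c x ec , lt
    ... | no ne with entry-prefix r0 le ec
    ...   | a , ea = a , trans (entry-replace-other r0 c x j ne) ea , ≤-<-trans (h j a (≤∧≢⇒< le ne) ea) lt
    -- replacing e by the smaller x keeps every old domination
    keep : ∀ j a b → entry r0 j ≡ just a → a < b → ∃[ a' ] (entry (replace r0 c x) j ≡ just a' × a' < b)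
    keep j a b ea ab with j ≟ c
    ... | yes refl = x , entry-replace-same r0 c x ec , <-trans lt (subst (_< b) (just-injective (trans (sym ea) ec)) ab)
    ... | no ne = a , trans (entry-replace-other r0 c x j ne) ea , ab
    -- e lands in r₁ at some column c' ≤ c: entries of r₁ before c' are ≤ e,
    -- while the entry of r₁ at column c would exceed e, which sits above it
    landing : ∀ r1 c' → Below e r1 c' → Dominates r0 r1 → (c < c' → ∃[ b ] entry r1 c ≡ just b) → c' ≤ c
    landing r1 c' h1 dh defined with c' ≤? c
    ... | yes p = p
    ... | no np with defined (≰⇒> np)
    ...   | b , eb with dh c b eb
    ...     | a , ea , ab = ⊥-elim (<⇒≱ (subst (_< b) (just-injective (trans (sym ea) ec)) ab) (h1 c b (≰⇒> np) eb))
    go : ∀ {T1 T1'} → Ins e T1 T1' → DominatesNext r0 T1 → DominatesNext (replace r0 c x) T1'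
    go new dh zero b refl = belowE 0 z≤n
    go new dh (suc j) b ()
    go (app {r1} h1) dh j b eb with j ≟ length r1
    ... | yes refl = subst (λ z → ∃[ a ] (entry (replace r0 c x) (length r1) ≡ just a × a < z))
                       (just-injective (trans (sym (entry-snoc-last r1 e)) eb))
                       (belowE (length r1) (landing r1 (length r1) (λ q a _ → h1 q a) dh (lt-entry r1 c)))
    ... | no ne with dh j b (trans (sym (entry-snoc-other r1 e j ne)) eb)
    ...   | a , ea , ab = keep j a b ea ab
    go (bump {r1} c' h1 ec' lt' I') dh j b eb with j ≟ c'
    ... | yes refl = subst (λ z → ∃[ a ] (entry (replace r0 c x) c' ≡ just a × a < z))
                       (just-injective (trans (sym (entry-replace-same r1 c' e ec')) eb))
                       (belowE c' (landing r1 c' h1 dh (λ l → entry-prefix r1 (<⇒≤ l) ec')))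
    ... | no ne with dh j b (trans (sym (entry-replace-other r1 c' e j ne)) eb)
    ...   | a , ea , ab = keep j a b ea ab

  ins-tableau : ∀ {x T T'} → Ins x T T' → IsTableau T → IsTableau T'
  ins-tableau new _ = (λ { zero a b _ () ; (suc q) a b () _ }) , (_ , refl) , tt , tt
  ins-tableau {x} (app {r} {T} h) (w , ne , dh , tb) = weakRow-snoc {r} {x} w h , nonEmpty-snoc r x , snocDom T dh , tb
    where
    snocDom : ∀ T → DominatesNext r T → DominatesNext (r ++ x ∷ []) T
    snocDom [] _ = tt
    snocDom (r1 ∷ _) d j b eb with d j b eb
    ... | a , ea , ab = a , entry-snoc-keep r x ea , ab
  ins-tableau {x} (bump {r} c h ec lt I) (w , ne , dh , tb) =
    weakRow-replace {r} {c} {x} w h ec lt , nonEmpty-replace {r} c x ne , dominates-bump w h ec lt dh I , ins-tableau I tb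

  -- Cells of a tableau: row i, column j (missing rows are empty).
  row : Tableau → ℕ → List ℕ
  row [] _ = []
  row (r ∷ T) zero = r
  row (r ∷ T) (suc i) = row T i

  cell : Tableau → ℕ → ℕ → Maybe ℕ
  cell T i j = entry (row T i) j

  column-strict : ∀ T → IsTableau T → ∀ i j b → cell T (suc i) j ≡ just b → ∃[ a ] (cell T i j ≡ just a × a < b)
  column-strict (r ∷ r1 ∷ T) (_ , _ , d , _) zero j b eb = d j b eb
  column-strict (r ∷ T) (_ , _ , _ , tb) (suc i) j b eb = column-strict T tb i j b eb

  row-weak : ∀ T → IsTableau T → ∀ i {j j' b} → j ≤ j' → cell T i j' ≡ just b → ∃[ a ] (cell T i j ≡ just a × a ≤ b)
  row-weak (r ∷ T) (w , _) zero {j} {j'} le eb with entry-prefix r le eb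
  ... | a , ea = a , ea , weakRow-mono r w le ea eb
  row-weak (r ∷ T) (_ , _ , _ , tb) (suc i) le eb = row-weak T tb i le eb

  column-weak : ∀ T → IsTableau T → ∀ {i i' j b} → i ≤ i' → cell T i' j ≡ just b → ∃[ a ] (cell T i j ≡ just a × a ≤ b)
  column-weak T tb {i} {zero} {j} {b} z≤n eb = b , eb , ≤-refl
  column-weak T tb {i} {suc i'} {j} {b} le eb with m≤n⇒m<n∨m≡n le
  ... | inj₂ refl = b , eb , ≤-refl
  ... | inj₁ (s≤s lt) with column-strict T tb i' j b eb
  ...   | a' , ea' , ab with column-weak T tb lt ea'
  ...     | a , ea , aa = a , ea , ≤-trans aa (<⇒≤ ab)

  row-length-decreasing : ∀ T → IsTableau T → ∀ i → length (row T (suc i)) ≤ length (row T i)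
  row-length-decreasing T tb i with length (row T (suc i)) in eq
  ... | zero = z≤n
  ... | suc L with lt-entry (row T (suc i)) L (subst (L <_) (sym eq) ≤-refl)
  ...   | b , eb with column-strict T tb i L b eb
  ...     | a , ea , _ = entry-lt (row T i) L ea

  column-empty-below : ∀ T → IsTableau T → ∀ {i i' j} → i ≤ i' → cell T i j ≡ nothing → cell T i' j ≡ nothing
  column-empty-below T tb {i} {i'} {j} le en with cell T i' j in eb
  ... | nothing = refl
  ... | just b with column-weak T tb le eb
  ...   | a , ea , _ with trans (sym en) ea
  ...     | ()

-- For tableaux S and A and column offsets p, the stacked
-- tableau reads column j from the top as: the cells of S in column j, then the
-- cells of A in column j starting at row p j.  Offsets are tracked row by row:
-- passing a row of S that does not reach column j increments the offset of j.
-- With p = 0 this is "S on top of A"; when every letter of A exceeds every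
-- letter of S, inserting further small letters into the stacked tableau keeps
-- it stacked (lemma `stack-insert`).
module ColumnStacking where

  open RowInsertion
  open TableauInvariant
  open import Data.Nat
  open import Data.Nat.Properties
  open import Data.List using (List; []; _∷_; _++_; length)
  open import Data.Maybe using (Maybe; just; nothing)
  open import Data.Maybe.Properties using (just-injective)
  open import Data.Product using (_×_; _,_; ∃-syntax; proj₁; proj₂)
  open import Data.Sum using (_⊎_; inj₁; inj₂)
  open import Data.Unit using (tt)
  open import Data.Empty using (⊥-elim)
  open import Relation.Nullary using (yes; no)
  open import Relation.Nullary.Decidable using (toSum)
  open import Relation.Binary.PropositionalEquality

  headRow : Tableau → List ℕ
  headRow [] = []
  headRow (r ∷ _) = r

  tailRows : Tableau → Tableau
  tailRows [] = []
  tailRows (_ ∷ T) = T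

  cell-head : ∀ S j → cell S 0 j ≡ entry (headRow S) j
  cell-head [] j = refl
  cell-head (r ∷ S) j = refl

  cell-tail : ∀ S i j → cell (tailRows S) i j ≡ cell S (suc i) j
  cell-tail [] i j = refl
  cell-tail (r ∷ S) i j = refl

  tableau-tail : ∀ S → IsTableau S → IsTableau (tailRows S)
  tableau-tail [] _ = tt
  tableau-tail (r ∷ S) (_ , _ , _ , t) = t

  nextOffset : List ℕ → (ℕ → ℕ) → ℕ → ℕ
  nextOffset r p j with j <? length r
  ... | yes _ = p j
  ... | no _ = suc (p j)

  nextOffset-inside : ∀ r p j → j < length r → nextOffset r p j ≡ p j
  nextOffset-inside r p j lt with j <? length r
  ... | yes _ = refl
  ... | no n = ⊥-elim (n lt)

  nextOffset-outside : ∀ r p j → length r ≤ j → nextOffset r p j ≡ suc (p j)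
  nextOffset-outside r p j ge with j <? length r
  ... | yes l = ⊥-elim (<⇒≱ l ge)
  ... | no _ = refl

  nextOffset-cong : ∀ r p q j → p j ≡ q j → nextOffset r p j ≡ nextOffset r q j
  nextOffset-cong r p q j e with j <? length r
  ... | yes _ = e
  ... | no _ = cong suc e

  nextOffset-≤ : ∀ r p j → nextOffset r p j ≤ suc (p j)
  nextOffset-≤ r p j with j <? length r
  ... | yes _ = n≤1+n _
  ... | no _ = ≤-refl

  offset-≤-nextOffset : ∀ r p j → p j ≤ nextOffset r p j
  offset-≤-nextOffset r p j with j <? length r
  ... | yes _ = ≤-refl
  ... | no _ = n≤1+n _

  nextOffset-length : ∀ r r' p j → length r ≡ length r' → nextOffset r p j ≡ nextOffset r' p j
  nextOffset-length r r' p j e with j <? length r | j <? length r'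
  ... | yes _ | yes _ = refl
  ... | yes a | no b = ⊥-elim (b (subst (j <_) e a))
  ... | no a | yes b = ⊥-elim (a (subst (j <_) (sym e) b))
  ... | no _ | no _ = refl

  nextOffset-snoc : ∀ r y p j → j ≢ length r → nextOffset (r ++ y ∷ []) p j ≡ nextOffset r p j
  nextOffset-snoc r y p j ne with j <? length (r ++ y ∷ []) | j <? length r
  ... | yes _ | yes _ = refl
  ... | yes a | no b = ⊥-elim (b (≤∧≢⇒< (≤-pred (subst (j <_) (length-snoc r y) a)) ne))
  ... | no a | yes b = ⊥-elim (a (subst (j <_) (sym (length-snoc r y)) (≤-trans b (n≤1+n _))))
  ... | no _ | no _ = refl

  Monotone : (ℕ → ℕ) → Set
  Monotone p = ∀ {j j'} → j ≤ j' → p j ≤ p j'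

  nextOffset-mono : ∀ r p → Monotone p → Monotone (nextOffset r p)
  nextOffset-mono r p mp {j} {j'} le with j <? length r | j' <? length r
  ... | yes _ | yes _ = mp le
  ... | yes _ | no _ = ≤-trans (mp le) (n≤1+n _)
  ... | no a | yes b = ⊥-elim (a (≤-<-trans le b))
  ... | no _ | no _ = s≤s (mp le)

  update : (ℕ → ℕ) → ℕ → ℕ → ℕ → ℕ
  update p c v j with j ≟ c
  ... | yes _ = v
  ... | no _ = p j

  update-same : ∀ p c v → update p c v c ≡ v
  update-same p c v with c ≟ c
  ... | yes _ = refl
  ... | no n = ⊥-elim (n refl)

  update-other : ∀ p c v j → j ≢ c → update p c v j ≡ p j
  update-other p c v j ne with j ≟ c
  ... | yes e = ⊥-elim (ne e)
  ... | no _ = refl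

  stackCell : Tableau → Tableau → (ℕ → ℕ) → ℕ → ℕ → Maybe ℕ
  stackCell S A p zero j with j <? length (headRow S)
  ... | yes _ = entry (headRow S) j
  ... | no _ = cell A (p j) j
  stackCell S A p (suc i) j = stackCell (tailRows S) A (nextOffset (headRow S) p) i j

  Stacked : Tableau → Tableau → (ℕ → ℕ) → Tableau → Set
  Stacked S A p T = ∀ i j → cell T i j ≡ stackCell S A p i j

  stackCell-offset : ∀ S A p q i j → p j ≡ q j → stackCell S A p i j ≡ stackCell S A q i j
  stackCell-offset S A p q zero j e with j <? length (headRow S)
  ... | yes _ = refl
  ... | no _ = cong (λ z → cell A z j) e
  stackCell-offset S A p q (suc i) j e =
    stackCell-offset (tailRows S) A (nextOffset (headRow S) p) (nextOffset (headRow S) q) i j (nextOffset-cong (headRow S) p q j e)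

  stackTop-inside : ∀ S A p j → j < length (headRow S) → stackCell S A p 0 j ≡ entry (headRow S) j
  stackTop-inside S A p j lt with j <? length (headRow S)
  ... | yes _ = refl
  ... | no n = ⊥-elim (n lt)

  stackTop-outside : ∀ S A p j → length (headRow S) ≤ j → stackCell S A p 0 j ≡ cell A (p j) j
  stackTop-outside S A p j ge with j <? length (headRow S)
  ... | yes l = ⊥-elim (<⇒≱ l ge)
  ... | no _ = refl

  Narrower : Tableau → ℕ → Set
  Narrower S c = ∀ i → length (row S i) ≤ c

  narrower-tail : ∀ S c → Narrower S c → Narrower (tailRows S) c
  narrower-tail [] c n i = z≤n
  narrower-tail (r ∷ S) c n i = n (suc i)

  narrower-head : ∀ S c → Narrower S c → length (headRow S) ≤ c
  narrower-head [] c n = z≤n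
  narrower-head (r ∷ S) c n = n 0

  tail-narrower : ∀ S → IsTableau S → Narrower (tailRows S) (length (headRow S))
  tail-narrower [] _ i = z≤n
  tail-narrower (r ∷ S1) tb zero = row-length-decreasing (r ∷ S1) tb 0
  tail-narrower (r ∷ S1) tb (suc i) = ≤-trans (row-length-decreasing (r ∷ S1) tb (suc i)) (tail-narrower (r ∷ S1) tb i)

  stackCell-beyond : ∀ S A p c i → Narrower S c → stackCell S A p i c ≡ cell A (p c + i) c
  stackCell-beyond S A p c zero n rewrite +-identityʳ (p c) = stackTop-outside S A p c (narrower-head S c n)
  stackCell-beyond S A p c (suc i) n rewrite +-suc (p c) i =
    trans (stackCell-beyond (tailRows S) A (nextOffset (headRow S) p) c i (narrower-tail S c n))
          (cong (λ z → cell A (z + i) c) (nextOffset-outside (headRow S) p c (narrower-head S c n)))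

  stackTop-snoc : ∀ A S y p j → j ≢ length (headRow S) →
    stackCell S A p 0 j ≡ stackCell ((headRow S ++ y ∷ []) ∷ tailRows S) A p 0 j
  stackTop-snoc A S y p j ne with <-≤-connex j (length (headRow S))
  ... | inj₁ l = trans (stackTop-inside S A p j l) (trans (sym (entry-snoc-other (headRow S) y j ne))
                   (sym (stackTop-inside ((headRow S ++ y ∷ []) ∷ tailRows S) A p j
                          (subst (j <_) (sym (length-snoc (headRow S) y)) (≤-trans l (n≤1+n _))))))
  ... | inj₂ l = trans (stackTop-outside S A p j l) (sym (stackTop-outside ((headRow S ++ y ∷ []) ∷ tailRows S) A p j
                   (subst (_≤ j) (sym (length-snoc (headRow S) y)) (≤∧≢⇒< l (λ z → ne (sym z))))))

  stackTop-replace : ∀ A r S1 S1' c y p j → j ≢ c → stackCell (r ∷ S1) A p 0 j ≡ stackCell (replace r c y ∷ S1') A p 0 j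
  stackTop-replace A r S1 S1' c y p j ne with <-≤-connex j (length r)
  ... | inj₁ l = trans (stackTop-inside (r ∷ S1) A p j l) (trans (sym (entry-replace-other r c y j ne))
                   (sym (stackTop-inside (replace r c y ∷ S1') A p j (subst (j <_) (sym (length-replace r c y)) l))))
  ... | inj₂ l = trans (stackTop-outside (r ∷ S1) A p j l)
                   (sym (stackTop-outside (replace r c y ∷ S1') A p j (subst (_≤ j) (sym (length-replace r c y)) l)))

  stackCell-source : ∀ S A p → IsTableau S → IsTableau A → ∀ i j {v} → stackCell S A p i j ≡ just v → ∀ i1 i2 → i1 + i2 ≡ i →
    (∃[ a ] cell S i2 j ≡ just a) ⊎ (∃[ a ] cell A (p j + i1) j ≡ just a)
  stackCell-source S A p tbS tbA zero j {v} e zero zero refl with <-≤-connex j (length (headRow S))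
  ... | inj₁ l = inj₁ (subst (λ z → ∃[ a ] z ≡ just a) (sym (cell-head S j)) (lt-entry (headRow S) j l))
  ... | inj₂ l = inj₂ (v , trans (cong (λ z → cell A z j) (+-identityʳ _)) (trans (sym (stackTop-outside S A p j l)) e))
  stackCell-source S A p tbS tbA (suc i) j e i1 zero eq with <-≤-connex j (length (headRow S))
  ... | inj₁ l = inj₁ (subst (λ z → ∃[ a ] z ≡ just a) (sym (cell-head S j)) (lt-entry (headRow S) j l))
  ... | inj₂ l with stackCell-source (tailRows S) A (nextOffset (headRow S) p) (tableau-tail S tbS) tbA i j e i 0 (+-identityʳ i)
  ...   | inj₁ (a , ea) with column-strict S tbS 0 j a (trans (sym (cell-tail S 0 j)) ea)
  ...     | b , eb , _ = inj₁ (b , eb)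
  stackCell-source S A p tbS tbA (suc i) j e i1 zero eq | inj₂ l | inj₂ (a , ea) =
    inj₂ (a , trans (cong (λ z → cell A z j) offsetEq) ea)
    where
    offsetEq : p j + i1 ≡ nextOffset (headRow S) p j + i
    offsetEq = trans (cong (p j +_) (trans (sym (+-identityʳ i1)) eq))
                     (trans (+-suc (p j) i) (cong (_+ i) (sym (nextOffset-outside (headRow S) p j l))))
  stackCell-source S A p tbS tbA (suc i) j e i1 (suc i2) eq
    with stackCell-source (tailRows S) A (nextOffset (headRow S) p) (tableau-tail S tbS) tbA i j e i1 i2 (suc-injective (trans (sym (+-suc i1 i2)) eq))
  ... | inj₁ (a , ea) = inj₁ (a , trans (sym (cell-tail S i2 j)) ea)
  ... | inj₂ (a , ea) with column-weak A tbA (+-monoˡ-≤ i1 (offset-≤-nextOffset (headRow S) p j)) ea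
  ...   | b , eb , _ = inj₂ (b , eb)

  -- Whenever such a letter lands in a column that the small
  -- tableau S has not reached, it pushes that column of A down by one row; the
  -- displaced letters of A cascade down the column (lemma `cascade`).
  module StackInsertion {m : ℕ} (A : Tableau) (tbA : IsTableau A)
                        (big : ∀ i j a → cell A i j ≡ just a → m < a) where

    AtMost : Tableau → Set
    AtMost S = ∀ i j s → cell S i j ≡ just s → s ≤ m

    stackCell-update-other : ∀ S p c v i j → j ≢ c → stackCell S A p i j ≡ stackCell S A (update p c v) i j
    stackCell-update-other S p c v i j ne = stackCell-offset S A p (update p c v) i j (sym (update-other p c v j ne))

    stackCell-column : ∀ S p c → Narrower S c → stackCell S A p 0 c ≡ cell A (p c) c
    stackCell-column S p c nar = trans (stackCell-beyond S A p c 0 nar) (cong (λ z → cell A z c) (+-identityʳ (p c)))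

    stackCell-shift : ∀ S p c q i → Narrower S c → p c ≡ suc q → stackCell S A (update p c q) (suc i) c ≡ stackCell S A p i c
    stackCell-shift S p c q i nar pc = begin
      stackCell S A (update p c q) (suc i) c ≡⟨ stackCell-beyond S A (update p c q) c (suc i) nar ⟩
      cell A (update p c q c + suc i) c      ≡⟨ cong (λ z → cell A (z + suc i) c) (update-same p c q) ⟩
      cell A (q + suc i) c                   ≡⟨ cong (λ z → cell A z c) (trans (+-suc q i) (cong (_+ i) (sym pc))) ⟩
      cell A (p c + i) c                     ≡⟨ sym (stackCell-beyond S A p c i nar) ⟩
      stackCell S A p i c                    ∎
      where open ≡-Reasoning

    stackCell-top-updated : ∀ S p c q → Narrower S c → stackCell S A (update p c q) 0 c ≡ cell A q c
    stackCell-top-updated S p c q nar = trans (stackCell-column S (update p c q) c nar) (cong (λ z → cell A z c) (update-same p c q))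

    nextOffset-update : ∀ h p c q → length h ≤ c → p c ≡ suc q →
      ∀ j → update (nextOffset h p) c (p c) j ≡ nextOffset h (update p c q) j
    nextOffset-update h p c q le pc j with toSum (j ≟ c)
    ... | inj₁ refl = trans (update-same _ c _)
                        (trans pc (sym (trans (nextOffset-outside h (update p c q) c le) (cong suc (update-same p c q)))))
    ... | inj₂ ne = trans (update-other (nextOffset h p) c _ j ne) (nextOffset-cong h p (update p c q) j (sym (update-other p c q j ne)))

    nextOffset-snoc-update : ∀ r y p j → update (nextOffset r p) (length r) (p (length r)) j ≡ nextOffset (r ++ y ∷ []) p j
    nextOffset-snoc-update r y p j with toSum (j ≟ length r)
    ... | inj₁ refl = trans (update-same _ (length r) _) (sym (nextOffset-inside (r ++ y ∷ []) p (length r) (subst (length r <_) (sym (length-snoc r y)) ≤-refl)))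
    ... | inj₂ ne = trans (update-other (nextOffset r p) (length r) _ j ne) (sym (nextOffset-snoc r y p j ne))

    -- The situation of a cascade step: the letter e at row q of column c of A
    -- is pushed out of the top of that column, which S does not reach; S is
    -- small, and columns left of c have been pushed down less than column c.
    record Cascading (S : Tableau) (p : ℕ → ℕ) (c q e : ℕ) : Set where
      field
        narrow : Narrower S c
        small : AtMost S
        before : ∀ j → j < c → p j < p c
        offset : p c ≡ suc q
        pushed : cell A q c ≡ just e
    open Cascading

    -- Left of column c the stacked top row is filled with letters ≤ e: letters
    -- of S are small, and the letters of A there lie weakly north-west of e.
    topRow-before : ∀ {S p c q e} → Cascading S p c q e → ∀ j → j < c → ∃[ a ] (stackCell S A p 0 j ≡ just a × a ≤ e)
    topRow-before {S} {p} cs j jc with <-≤-connex j (length (headRow S))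
    ... | inj₁ l with lt-entry (headRow S) j l
    ...   | a , ea = a , trans (stackTop-inside S A p j l) ea ,
                     ≤-trans (small cs 0 j a (trans (cell-head S j) ea)) (<⇒≤ (big _ _ _ (pushed cs)))
    topRow-before {S} {p} {q = q} cs j jc | inj₂ l with row-weak A tbA q (<⇒≤ jc) (pushed cs)
    ...   | b , eb , be with column-weak A tbA {p j} {q} (≤-pred (subst (p j <_) (offset cs) (before cs j jc))) eb
    ...     | a , ea , ab = a , trans (stackTop-outside S A p j l) ea , ≤-trans ab be

    topRow-≤ : ∀ {S p c q e} → Cascading S p c q e → ∀ j a → j < c → stackCell S A p 0 j ≡ just a → a ≤ e
    topRow-≤ {e = e} cs j a jc ea with topRow-before cs j jc
    ... | a' , ea' , le = subst (_≤ e) (just-injective (trans (sym ea') ea)) le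

    cascading-next : ∀ {S p c q e e'} → Cascading S p c q e → cell A (p c) c ≡ just e' →
      Cascading (tailRows S) (nextOffset (headRow S) p) c (p c) e'
    cascading-next {S} {p} {c} cs ee' = record
      { narrow = narrower-tail S c (narrow cs)
      ; small = λ i j s es → small cs (suc i) j s (trans (sym (cell-tail S i j)) es)
      ; before = λ j jc → subst (nextOffset (headRow S) p j <_) (sym next-c) (s≤s (≤-trans (nextOffset-≤ (headRow S) p j) (before cs j jc)))
      ; offset = next-c
      ; pushed = ee' }
      where
      next-c : nextOffset (headRow S) p c ≡ suc (p c)
      next-c = nextOffset-outside (headRow S) p c (narrower-head S c (narrow cs))

    cascade : ∀ T {S p c q e} → Stacked S A p T → Cascading S p c q e → ∃[ T' ] (Ins e T T' × Stacked S A (update p c q) T')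
    cascade-bump : ∀ t0 T1 {S p c q e e'} → Stacked S A p (t0 ∷ T1) → Cascading S p c q e → cell A (p c) c ≡ just e' →
      ∃[ T' ] (Ins e (t0 ∷ T1) T' × Stacked S A (update p c q) T')
    cascade-end : ∀ t0 T1 {S p c q e} → Stacked S A p (t0 ∷ T1) → Cascading S p c q e → cell A (p c) c ≡ nothing →
      ∃[ T' ] (Ins e (t0 ∷ T1) T' × Stacked S A (update p c q) T')

    cascade [] {S} {p} {zero} {q} {e} stk cs = _ , new , stacked
      where
      stacked : Stacked S A (update p 0 q) ((e ∷ []) ∷ [])
      stacked zero zero = sym (trans (stackCell-top-updated S p 0 q (narrow cs)) (pushed cs))
      stacked zero (suc j) = trans (stk 0 (suc j)) (stackCell-update-other S p 0 q 0 (suc j) (λ ()))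
      stacked (suc i) zero = trans (stk i 0) (sym (stackCell-shift S p 0 q i (narrow cs) (offset cs)))
      stacked (suc i) (suc j) = trans (stk (suc i) (suc j)) (stackCell-update-other S p 0 q (suc i) (suc j) (λ ()))
    cascade [] {c = suc c} stk cs with topRow-before cs 0 (s≤s z≤n)
    ... | a , ea , _ with trans (stk 0 0) ea
    ...   | ()
    cascade (t0 ∷ T1) {p = p} {c} stk cs with cell A (p c) c in ee'
    ... | just e' = cascade-bump t0 T1 stk cs ee'
    ... | nothing = cascade-end t0 T1 stk cs ee'

    cascade-bump t0 T1 {S} {p} {c} {q} {e} {e'} stk cs ee' = _ , bump c below t0c e<e' (proj₁ (proj₂ rec)) , stacked
      where
      below : Below e t0 c
      below j a jc eq = topRow-≤ cs j a jc (trans (sym (stk 0 j)) eq)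
      t0c : entry t0 c ≡ just e'
      t0c = trans (stk 0 c) (trans (stackCell-column S p c (narrow cs)) ee')
      e<e' : e < e'
      e<e' with column-strict A tbA q c e' (trans (cong (λ z → cell A z c) (sym (offset cs))) ee')
      ... | a , ea , ab = subst (_< e') (just-injective (trans (sym ea) (pushed cs))) ab
      rec : ∃[ T' ] (Ins e' T1 T' × Stacked (tailRows S) A (update (nextOffset (headRow S) p) c (p c)) T')
      rec = cascade T1 (λ i j → stk (suc i) j) (cascading-next cs ee')
      stacked : Stacked S A (update p c q) (replace t0 c e ∷ proj₁ rec)
      stacked zero j with toSum (j ≟ c)
      ... | inj₁ refl = trans (entry-replace-same t0 c e t0c) (sym (trans (stackCell-top-updated S p c q (narrow cs)) (pushed cs)))
      ... | inj₂ ne = trans (entry-replace-other t0 c e j ne) (trans (stk 0 j) (stackCell-update-other S p c q 0 j ne))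
      stacked (suc i) j = trans (proj₂ (proj₂ rec) i j)
        (stackCell-offset (tailRows S) A _ _ i j (nextOffset-update (headRow S) p c q (narrower-head S c (narrow cs)) (offset cs) j))

    cascade-end t0 T1 {S} {p} {c} {q} {e} stk cs ee' = _ , app below , stacked
      where
      t0c : entry t0 c ≡ nothing
      t0c = trans (stk 0 c) (trans (stackCell-column S p c (narrow cs)) ee')
      lenc : length t0 ≡ c
      lenc = length-exact t0 c (λ j jc → let (a , ea , _) = topRow-before cs j jc in a , trans (stk 0 j) ea) t0c
      below : AllBelow e t0
      below j a eq = topRow-≤ cs j a (subst (j <_) lenc (entry-lt t0 j eq)) (trans (sym (stk 0 j)) eq)
      emptyAt : ∀ i → stackCell S A p i c ≡ nothing
      emptyAt i = trans (stackCell-beyond S A p c i (narrow cs)) (column-empty-below A tbA (m≤m+n (p c) i) ee')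
      stacked : Stacked S A (update p c q) ((t0 ++ e ∷ []) ∷ T1)
      stacked zero j with toSum (j ≟ c)
      ... | inj₁ refl = trans (subst (λ z → entry (t0 ++ e ∷ []) z ≡ just e) lenc (entry-snoc-last t0 e))
                             (sym (trans (stackCell-top-updated S p c q (narrow cs)) (pushed cs)))
      ... | inj₂ ne = trans (entry-snoc-other t0 e j (λ z → ne (trans z lenc))) (trans (stk 0 j) (stackCell-update-other S p c q 0 j ne))
      stacked (suc i) j with toSum (j ≟ c)
      ... | inj₁ refl = trans (stk (suc i) c) (trans (emptyAt (suc i)) (sym (trans (stackCell-shift S p c q i (narrow cs) (offset cs)) (emptyAt i))))
      ... | inj₂ ne = trans (stk (suc i) j) (stackCell-update-other S p c q (suc i) j ne)

    -- A small letter y appended to the first row r of S: in the stacked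
    -- tableau y lands at the top of the column c = |r| just beyond r.
    stack-append : ∀ {y} S T p → IsTableau S → IsTableau T → Monotone p → Stacked S A p T → AtMost S → y ≤ m →
      AllBelow y (headRow S) → ∃[ T' ] (Ins y T T' × Stacked ((headRow S ++ y ∷ []) ∷ tailRows S) A p T')
    stack-append-bump : ∀ {y e} S t0 T1 p → IsTableau S → Monotone p → Stacked S A p (t0 ∷ T1) → AtMost S → y ≤ m →
      AllBelow y (headRow S) → cell A (p (length (headRow S))) (length (headRow S)) ≡ just e →
      ∃[ T' ] (Ins y (t0 ∷ T1) T' × Stacked ((headRow S ++ y ∷ []) ∷ tailRows S) A p T')
    stack-append-end : ∀ {y} S t0 T1 p → IsTableau S → Stacked S A p (t0 ∷ T1) →
      AllBelow y (headRow S) → cell A (p (length (headRow S))) (length (headRow S)) ≡ nothing →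
      ∃[ T' ] (Ins y (t0 ∷ T1) T' × Stacked ((headRow S ++ y ∷ []) ∷ tailRows S) A p T')

    stack-append {y} [] [] p tbS tbT mp stk small ym h with cell A (p 0) 0 in en
    ... | just e with trans (stk 0 0) en
    ...   | ()
    stack-append {y} [] [] p tbS tbT mp stk small ym h | nothing = _ , new , stacked
      where
      stacked : Stacked ((y ∷ []) ∷ []) A p ((y ∷ []) ∷ [])
      stacked zero zero = refl
      stacked zero (suc j) = stk 0 (suc j)
      stacked (suc i) j with toSum (j ≟ 0)
      ... | inj₁ refl = sym (trans (stackCell-beyond [] A (nextOffset (y ∷ []) p) 0 i (λ _ → z≤n))
                                   (column-empty-below A tbA (m≤m+n _ i) en))
      ... | inj₂ ne = trans (stk (suc i) j) (stackCell-offset [] A _ _ i j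
                        (trans (nextOffset-outside [] p j z≤n) (sym (nextOffset-outside (y ∷ []) p j (≤∧≢⇒< z≤n (λ z → ne (sym z)))))))
    stack-append (r ∷ S1) [] p (_ , (a , ea) , _) tbT mp stk small ym h
      with trans (stk 0 0) (trans (stackTop-inside (r ∷ S1) A p 0 (entry-lt r 0 ea)) ea)
    ... | ()
    stack-append S (t0 ∷ T1) p tbS tbT mp stk small ym h with cell A (p (length (headRow S))) (length (headRow S)) in ee
    ... | just e = stack-append-bump S t0 T1 p tbS mp stk small ym h ee
    ... | nothing = stack-append-end S t0 T1 p tbS stk h ee

    stack-append-bump {y} {e} S t0 T1 p tbS mp stk small ym h ee =
      _ , bump c below t0c (≤-<-trans ym (big _ _ _ ee)) (proj₁ (proj₂ rec)) , stacked
      where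
      r : List ℕ
      r = headRow S
      c : ℕ
      c = length r
      below : Below y t0 c
      below j a jc eq = h j a (trans (sym (stackTop-inside S A p j jc)) (trans (sym (stk 0 j)) eq))
      t0c : entry t0 c ≡ just e
      t0c = trans (stk 0 c) (trans (stackTop-outside S A p c ≤-refl) ee)
      cs : Cascading (tailRows S) (nextOffset r p) c (p c) e
      cs = record
        { narrow = tail-narrower S tbS
        ; small = λ i j s es → small (suc i) j s (trans (sym (cell-tail S i j)) es)
        ; before = λ j jc → subst (nextOffset r p j <_) (sym (nextOffset-outside r p c ≤-refl))
                                 (subst (_< suc (p c)) (sym (nextOffset-inside r p j jc)) (s≤s (mp (<⇒≤ jc))))
        ; offset = nextOffset-outside r p c ≤-refl
        ; pushed = ee }
      rec : ∃[ T' ] (Ins e T1 T' × Stacked (tailRows S) A (update (nextOffset r p) c (p c)) T')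
      rec = cascade T1 (λ i j → stk (suc i) j) cs
      stacked : Stacked ((r ++ y ∷ []) ∷ tailRows S) A p (replace t0 c y ∷ proj₁ rec)
      stacked zero j with toSum (j ≟ c)
      ... | inj₁ refl = trans (entry-replace-same t0 c y t0c)
                          (sym (trans (stackTop-inside ((r ++ y ∷ []) ∷ tailRows S) A p c
                                         (subst (c <_) (sym (length-snoc r y)) ≤-refl))
                                      (entry-snoc-last r y)))
      ... | inj₂ ne = trans (entry-replace-other t0 c y j ne) (trans (stk 0 j) (stackTop-snoc A S y p j ne))
      stacked (suc i) j = trans (proj₂ (proj₂ rec) i j) (stackCell-offset (tailRows S) A _ _ i j (nextOffset-snoc-update r y p j))

    stack-append-end {y} S t0 T1 p tbS stk h ee = _ , app below , stacked
      where
      r : List ℕ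
      r = headRow S
      c : ℕ
      c = length r
      lt1 : c < length (r ++ y ∷ [])
      lt1 = subst (c <_) (sym (length-snoc r y)) ≤-refl
      nar : Narrower (tailRows S) c
      nar = tail-narrower S tbS
      t0c : entry t0 c ≡ nothing
      t0c = trans (stk 0 c) (trans (stackTop-outside S A p c ≤-refl) ee)
      lenc : length t0 ≡ c
      lenc = length-exact t0 c (λ j jc → let (a , ea) = lt-entry r j jc in a , trans (stk 0 j) (trans (stackTop-inside S A p j jc) ea)) t0c
      below : AllBelow y t0
      below j a eq = h j a (trans (sym (stackTop-inside S A p j (subst (j <_) lenc (entry-lt t0 j eq)))) (trans (sym (stk 0 j)) eq))
      emptyFrom : ∀ {i} → p c ≤ i → cell A i c ≡ nothing
      emptyFrom le = column-empty-below A tbA le ee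
      stacked : Stacked ((r ++ y ∷ []) ∷ tailRows S) A p ((t0 ++ y ∷ []) ∷ T1)
      stacked zero j with toSum (j ≟ c)
      ... | inj₁ refl = trans (subst (λ z → entry (t0 ++ y ∷ []) z ≡ just y) lenc (entry-snoc-last t0 y))
                          (sym (trans (stackTop-inside ((r ++ y ∷ []) ∷ tailRows S) A p c lt1) (entry-snoc-last r y)))
      ... | inj₂ ne = trans (entry-snoc-other t0 y j (λ z → ne (trans z lenc))) (trans (stk 0 j) (stackTop-snoc A S y p j ne))
      stacked (suc i) j with toSum (j ≟ c)
      ... | inj₁ refl = trans (stk (suc i) c) (trans (stackCell-beyond (tailRows S) A (nextOffset r p) c i nar)
                          (trans (emptyFrom le1) (sym (trans (stackCell-beyond (tailRows S) A (nextOffset (r ++ y ∷ []) p) c i nar) (emptyFrom le2)))))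
        where
        le1 : p c ≤ nextOffset r p c + i
        le1 = ≤-trans (n≤1+n _) (≤-trans (≤-reflexive (sym (nextOffset-outside r p c ≤-refl))) (m≤m+n _ i))
        le2 : p c ≤ nextOffset (r ++ y ∷ []) p c + i
        le2 = ≤-trans (≤-reflexive (sym (nextOffset-inside (r ++ y ∷ []) p c lt1))) (m≤m+n _ i)
      ... | inj₂ ne = trans (stk (suc i) j) (stackCell-offset (tailRows S) A _ _ i j (sym (nextOffset-snoc r y p j ne)))

    -- Offsets stay 0 at the outermost
    -- level, but are needed in general for the rows below the first.
    stack-insert : ∀ {y S S'} → Ins y S S' → ∀ T p → IsTableau S → IsTableau T → Monotone p → Stacked S A p T →
      AtMost S → y ≤ m → ∃[ T' ] (Ins y T T' × Stacked S' A p T')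
    stack-insert new T p tbS tbT mp stk small ym = stack-append [] T p tbS tbT mp stk small ym (λ q a ())
    stack-insert (app {r} {S1} h) T p tbS tbT mp stk small ym = stack-append (r ∷ S1) T p tbS tbT mp stk small ym h
    stack-insert (bump {r} {S1} c h ec lt I) [] p (_ , (a , ea) , _) tbT mp stk small ym
      with trans (stk 0 0) (trans (stackTop-inside (r ∷ S1) A p 0 (entry-lt r 0 ea)) ea)
    ... | ()
    stack-insert {y} (bump {r} {S1} {S1'} c {e} h ec lt I) (t0 ∷ T1) p tbS tbT mp stk small ym =
        _ , bump c below t0c lt (proj₁ (proj₂ rec)) , stacked
      where
      cl : c < length r
      cl = entry-lt r c ec
      below : Below y t0 c
      below q a qc eq = h q a qc (trans (sym (stackTop-inside (r ∷ S1) A p q (<-trans qc cl))) (trans (sym (stk 0 q)) eq))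
      t0c : entry t0 c ≡ just e
      t0c = trans (stk 0 c) (trans (stackTop-inside (r ∷ S1) A p c cl) ec)
      rec : ∃[ T' ] (Ins e T1 T' × Stacked S1' A (nextOffset r p) T')
      rec = stack-insert I T1 (nextOffset r p) (proj₂ (proj₂ (proj₂ tbS))) (proj₂ (proj₂ (proj₂ tbT))) (nextOffset-mono r p mp)
              (λ i j → stk (suc i) j) (λ i j s es → small (suc i) j s es) (small 0 c e ec)
      stacked : Stacked (replace r c y ∷ S1') A p (replace t0 c y ∷ proj₁ rec)
      stacked zero j with toSum (j ≟ c)
      ... | inj₁ refl = trans (entry-replace-same t0 c y t0c)
                          (sym (trans (stackTop-inside (replace r c y ∷ S1') A p c (subst (c <_) (sym (length-replace r c y)) cl))
                                      (entry-replace-same r c y ec)))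
      ... | inj₂ ne = trans (entry-replace-other t0 c y j ne) (trans (stk 0 j) (stackTop-replace A r S1 S1' c y p j ne))
      stacked (suc i) j = trans (proj₂ (proj₂ rec) i j)
                            (stackCell-offset S1' A _ _ i j (nextOffset-length r (replace r c y) p j (sym (length-replace r c y))))

module SumShapes where

  open RowInsertion
  open TableauInvariant
  open ColumnStacking
  open import Data.Nat
  open import Data.Nat.Properties
  open import Data.List using (List; []; _∷_; _++_; length; foldl; map)
  open import Data.List.Properties using (length-++; foldl-++)
  open import Data.List.Relation.Unary.All as All using (All; []; _∷_)
  open import Data.List.Relation.Unary.All.Properties using (++⁺)
  open import Data.Maybe using (just; nothing)
  open import Data.Product using (_,_; proj₁; proj₂)
  open import Data.Sum using (inj₁; inj₂)
  open import Data.Unit using (tt)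
  open import Data.Empty using (⊥-elim)
  open import Relation.Nullary using (yes; no)
  open import Relation.Binary.PropositionalEquality

  insertInto : Tableau → ℕ → Tableau
  insertInto T x = insTab x T

  tableauOf : List ℕ → Tableau
  tableauOf w = foldl insertInto [] w

  shapeOf : List ℕ → List ℕ
  shapeOf w = map length (tableauOf w)

  tableauOf-++ : ∀ A B → tableauOf (A ++ B) ≡ foldl insertInto (tableauOf A) B
  tableauOf-++ A B = foldl-++ insertInto [] A B

  part-length : ∀ T k → part (map length T) k ≡ length (row T k)
  part-length [] zero = refl
  part-length [] (suc k) = refl
  part-length (r ∷ T) zero = refl
  part-length (r ∷ T) (suc k) = part-length T k

  tableauOf-isTableau : ∀ w → IsTableau (tableauOf w)
  tableauOf-isTableau w = go w [] tt
    where
    go : ∀ w T → IsTableau T → IsTableau (foldl insertInto T w)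
    go [] T tb = tb
    go (x ∷ w) T tb = go w (insTab x T) (ins-tableau (ins-insTab x T) tb)

  -- Every entry of the tableau satisfies Q.  Insertion only moves letters, so
  -- the entries of the insertion tableau of w satisfy whatever all letters of
  -- w satisfy.
  AllEntries : (ℕ → Set) → Tableau → Set
  AllEntries Q T = All (All Q) T

  entry-all : ∀ {Q : ℕ → Set} {r} q {a} → All Q r → entry r q ≡ just a → Q a
  entry-all zero (px ∷ _) refl = px
  entry-all (suc q) (_ ∷ ps) e = entry-all q ps e

  cell-all : ∀ {Q : ℕ → Set} T i j {a} → AllEntries Q T → cell T i j ≡ just a → Q a
  cell-all (r ∷ T) zero j (pr ∷ _) e = entry-all j pr e
  cell-all (r ∷ T) (suc i) j (_ ∷ ps) e = cell-all T i j ps e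

  replace-all : ∀ {Q : ℕ → Set} r c x → All Q r → Q x → All Q (replace r c x)
  replace-all [] c x _ _ = []
  replace-all (y ∷ r) zero x (_ ∷ ps) qx = qx ∷ ps
  replace-all (y ∷ r) (suc c) x (p ∷ ps) qx = p ∷ replace-all r c x ps qx

  ins-all : ∀ {Q : ℕ → Set} {x T T'} → Ins x T T' → Q x → AllEntries Q T → AllEntries Q T'
  ins-all new qx _ = (qx ∷ []) ∷ []
  ins-all (app h) qx (pr ∷ ps) = ++⁺ pr (qx ∷ []) ∷ ps
  ins-all (bump {r} c h ec lt I) qx (pr ∷ ps) = replace-all r c _ pr qx ∷ ins-all I (entry-all c pr ec) ps

  insTab-all : ∀ {Q : ℕ → Set} x T → Q x → AllEntries Q T → AllEntries Q (insTab x T)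
  insTab-all x T qx a = ins-all (ins-insTab x T) qx a

  tableauOf-all : ∀ {Q : ℕ → Set} w → All Q w → AllEntries Q (tableauOf w)
  tableauOf-all {Q} w qw = go w [] qw []
    where
    go : ∀ w T → All Q w → AllEntries Q T → AllEntries Q (foldl insertInto T w)
    go [] T _ a = a
    go (x ∷ w) T (qx ∷ qw) a = go w (insTab x T) qw (insTab-all x T qx a)

  stacked-fold : ∀ {m} A → IsTableau A → (∀ i j a → cell A i j ≡ just a → m < a) →
    ∀ B S T → IsTableau S → IsTableau T → Stacked S A (λ _ → 0) T → AllEntries (_≤ m) S → All (_≤ m) B →
    Stacked (foldl insertInto S B) A (λ _ → 0) (foldl insertInto T B)
  stacked-fold A tbA big [] S T tbS tbT stk sm _ = stk
  stacked-fold {m} A tbA big (y ∷ B) S T tbS tbT stk sm (ym ∷ bm)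
    with StackInsertion.stack-insert {m} A tbA big (ins-insTab y S) T (λ _ → 0) tbS tbT (λ _ → z≤n) stk (λ i j s e → cell-all S i j sm e) ym
  ... | T' , I , stk' rewrite sym (ins-sound I) =
    stacked-fold A tbA big B (insTab y S) (insTab y T) (ins-tableau (ins-insTab y S) tbS) (ins-tableau (ins-insTab y T) tbT)
                 stk' (insTab-all y S ym sm) bm

  skew-stacked : ∀ {m} A B → All (m <_) A → All (_≤ m) B → Stacked (tableauOf B) (tableauOf A) (λ _ → 0) (tableauOf (A ++ B))
  skew-stacked A B am bm rewrite tableauOf-++ A B =
    stacked-fold (tableauOf A) (tableauOf-isTableau A) (λ i j a e → cell-all (tableauOf A) i j (tableauOf-all A am) e)
                 B [] (tableauOf A) tt (tableauOf-isTableau A)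
                 (λ i j → sym (stackCell-beyond [] (tableauOf A) (λ _ → 0) j i (λ _ → z≤n))) [] bm

  -- In S stacked on A, a row below k₁ + k₂ is no longer than row k₁ of A or
  -- row k₂ of S: its last cell comes from S above row k₂ or from A below row k₁.
  stacked-row-bound : ∀ S A T → IsTableau S → IsTableau A → Stacked S A (λ _ → 0) T →
    ∀ k1 k2 → length (row T (k1 + k2)) ≤ length (row A k1) ⊔ length (row S k2)
  stacked-row-bound S A T tbS tbA stk k1 k2 with length (row T (k1 + k2)) in eq
  ... | zero = z≤n
  ... | suc L with lt-entry (row T (k1 + k2)) L (subst (L <_) (sym eq) ≤-refl)
  ...   | v , ev with stackCell-source S A (λ _ → 0) tbS tbA (k1 + k2) L (trans (sym (stk (k1 + k2) L)) ev) k1 k2 refl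
  ...     | inj₁ (a , ea) = ≤-trans (entry-lt (row S k2) L ea) (m≤n⊔m _ _)
  ...     | inj₂ (a , ea) = ≤-trans (entry-lt (row A k1) L ea) (m≤m⊔n _ _)

  skew-shape-bound : ∀ {m} A B → All (m <_) A → All (_≤ m) B → ∀ k1 k2 →
    part (shapeOf (A ++ B)) (k1 + k2) ≤ part (shapeOf A) k1 ⊔ part (shapeOf B) k2
  skew-shape-bound A B am bm k1 k2
    rewrite part-length (tableauOf (A ++ B)) (k1 + k2) | part-length (tableauOf A) k1 | part-length (tableauOf B) k2 =
    stacked-row-bound (tableauOf B) (tableauOf A) (tableauOf (A ++ B)) (tableauOf-isTableau B) (tableauOf-isTableau A)
                      (skew-stacked A B am bm) k1 k2

  zipRows : Tableau → Tableau → Tableau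
  zipRows [] S = S
  zipRows (t ∷ T) [] = t ∷ T
  zipRows (t ∷ T) (s ∷ S) = (t ++ s) ∷ zipRows T S

  zipRows-nil : ∀ T → zipRows T [] ≡ T
  zipRows-nil [] = refl
  zipRows-nil (t ∷ T) = refl

  insRow-prefix : ∀ z t s → All (_< z) t → insRow z (t ++ s) ≡ (proj₁ (insRow z s) , t ++ proj₂ (insRow z s))
  insRow-prefix z [] s _ = refl
  insRow-prefix z (y ∷ t) s (yz ∷ h) with z <? y
  ... | yes p = ⊥-elim (<-asym p yz)
  ... | no _ rewrite insRow-prefix z t s h = refl

  insRow-bumped : ∀ {Q : ℕ → Set} z s {y r'} → insRow z s ≡ (just y , r') → All Q s → Q y
  insRow-bumped z [] () _
  insRow-bumped z (x ∷ s) eq (qx ∷ qs) with z <? x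
  insRow-bumped z (x ∷ s) refl (qx ∷ qs) | yes _ = qx
  ... | no _ with insRow z s in e
  insRow-bumped z (x ∷ s) refl (qx ∷ qs) | no _ | just y , r = insRow-bumped z s e qs

  ins-zipRows : ∀ {m} z T S → AllEntries (_≤ m) T → m < z → AllEntries (m <_) S →
    insTab z (zipRows T S) ≡ zipRows T (insTab z S)
  ins-zipRows z [] S _ _ _ = refl
  ins-zipRows z (t ∷ T) [] (ht ∷ _) mz _
    rewrite insRow-append z t (λ q a e → ≤-trans (entry-all q ht e) (<⇒≤ mz)) | zipRows-nil T = refl
  ins-zipRows z (t ∷ T) (s ∷ S) (ht ∷ hT) mz (hs ∷ hS)
    rewrite insRow-prefix z t s (All.map (λ a≤m → ≤-<-trans a≤m mz) ht) with insRow z s in e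
  ... | nothing , s' = refl
  ... | just y , s' = cong ((t ++ s') ∷_) (ins-zipRows y T S hT (insRow-bumped z s e hs) hS)

  fold-zipRows : ∀ {m} B TA S → AllEntries (_≤ m) TA → All (m <_) B → AllEntries (m <_) S →
    foldl insertInto (zipRows TA S) B ≡ zipRows TA (foldl insertInto S B)
  fold-zipRows [] TA S _ _ _ = refl
  fold-zipRows (z ∷ B) TA S ha (mz ∷ hb) hs
    rewrite ins-zipRows z TA S ha mz hs = fold-zipRows B TA (insTab z S) ha hb (insTab-all z S mz hs)

  row-zipRows : ∀ T S k → length (row (zipRows T S) k) ≡ length (row T k) + length (row S k)
  row-zipRows [] S k = refl
  row-zipRows (t ∷ T) [] zero = sym (+-identityʳ _)
  row-zipRows (t ∷ T) [] (suc k) = sym (+-identityʳ _)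
  row-zipRows (t ∷ T) (s ∷ S) zero = length-++ t
  row-zipRows (t ∷ T) (s ∷ S) (suc k) = row-zipRows T S k

  direct-tableau : ∀ {m} A B → All (_≤ m) A → All (m <_) B → tableauOf (A ++ B) ≡ zipRows (tableauOf A) (tableauOf B)
  direct-tableau A B am bm = begin
    tableauOf (A ++ B)                               ≡⟨ tableauOf-++ A B ⟩
    foldl insertInto (tableauOf A) B                 ≡⟨ cong (λ z → foldl insertInto z B) (sym (zipRows-nil (tableauOf A))) ⟩
    foldl insertInto (zipRows (tableauOf A) []) B    ≡⟨ fold-zipRows B (tableauOf A) [] (tableauOf-all A am) bm [] ⟩
    zipRows (tableauOf A) (tableauOf B)              ∎
    where open ≡-Reasoning

  direct-shape : ∀ {m} A B → All (_≤ m) A → All (m <_) B → ∀ k →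
    part (shapeOf (A ++ B)) k ≡ part (shapeOf A) k + part (shapeOf B) k
  direct-shape A B am bm k
    rewrite direct-tableau A B am bm | part-length (zipRows (tableauOf A) (tableauOf B)) k
          | part-length (tableauOf A) k | part-length (tableauOf B) k = row-zipRows (tableauOf A) (tableauOf B) k

-- The split is found
-- letter by letter: if w has a split into two blocks, so does w followed by a
-- new letter z, unless z completes one of the two forbidden patterns.
module SeparableWords where

  open import Data.Nat
  open import Data.Nat.Properties
  open import Data.List using (List; []; _∷_; _++_; length; _∷ʳ′_; initLast)
  open import Data.List.Properties using (length-++; ++-assoc; ++-identityʳ)
  open import Data.List.Relation.Unary.All as All using (All; []; _∷_; all?)
  open import Data.List.Relation.Unary.All.Properties using (¬All⇒Any¬; ++⁻ˡ; ++⁻ʳ; ++⁺)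
  open import Data.List.Relation.Unary.AllPairs using (AllPairs; []; _∷_)
  open import Data.List.Relation.Unary.Unique.Propositional {A = ℕ} using (Unique)
  open import Data.List.Membership.Propositional using (find)
  open import Data.List.Relation.Binary.Sublist.Propositional using (_⊆_; []; _∷_; _∷ʳ_; ⊆-trans; ⊆-refl; minimum; from∈)
  open import Data.List.Relation.Binary.Sublist.Propositional.Properties using (++⁺ˡ; ++⁺ʳ; All-resp-⊆)
  import Data.List.Relation.Binary.Sublist.Propositional.Properties as Sublist
  open import Data.Product using (_×_; _,_; ∃-syntax; proj₁; proj₂)
  open import Data.Sum using (_⊎_; inj₁; inj₂)
  open import Data.Empty using (⊥; ⊥-elim)
  open import Relation.Nullary using (¬_; yes; no; Dec)
  open import Relation.Binary.PropositionalEquality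
  open import Relation.Binary using (tri<; tri≈; tri>)

  data SepWord : List ℕ → Set where
    empty : SepWord []
    single : ∀ x → SepWord (x ∷ [])
    directSum : ∀ {a A b B} → All (λ x → All (x <_) (b ∷ B)) (a ∷ A) → SepWord (a ∷ A) → SepWord (b ∷ B) →
                SepWord ((a ∷ A) ++ (b ∷ B))
    skewSum : ∀ {a A b B} → All (λ x → All (_< x) (b ∷ B)) (a ∷ A) → SepWord (a ∷ A) → SepWord (b ∷ B) →
              SepWord ((a ∷ A) ++ (b ∷ B))

  Pattern3142 Pattern2413 : ℕ → ℕ → ℕ → ℕ → Set
  Pattern3142 a b c d = b < d × d < a × a < c
  Pattern2413 a b c d = c < a × a < d × d < b

  Avoids : List ℕ → Set
  Avoids w = ∀ a b c d → (a ∷ b ∷ c ∷ d ∷ []) ⊆ w → ¬ Pattern3142 a b c d × ¬ Pattern2413 a b c d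

  avoids-⊆ : ∀ {xs ys} → xs ⊆ ys → Avoids ys → Avoids xs
  avoids-⊆ s av a b c d t = av a b c d (⊆-trans t s)

  allPairs-⊆ : ∀ {R : ℕ → ℕ → Set} {xs ys} → xs ⊆ ys → AllPairs R ys → AllPairs R xs
  allPairs-⊆ [] u = u
  allPairs-⊆ (y ∷ʳ s) (_ ∷ u) = allPairs-⊆ s u
  allPairs-⊆ (refl ∷ s) (p ∷ u) = All-resp-⊆ s p ∷ allPairs-⊆ s u

  unique-last : ∀ xs z → Unique (xs ++ z ∷ []) → All (z ≢_) xs
  unique-last [] z _ = []
  unique-last (x ∷ xs) z (p ∷ u) = ≢-sym (All.head (++⁻ʳ xs p)) ∷ unique-last xs z u

  -- Splits into two non-empty blocks, for a strict order ≺ (used for < and >).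
  module Splitting (_≺_ : ℕ → ℕ → Set) (≺? : ∀ x y → Dec (x ≺ y)) (≺-trans : ∀ {x y z} → x ≺ y → y ≺ z → x ≺ z)
                   (≺-connex : ∀ {x y} → x ≢ y → ¬ x ≺ y → y ≺ x) where

    data Split (w : List ℕ) : Set where
      ascending : ∀ a A b B → w ≡ (a ∷ A) ++ (b ∷ B) → All (λ x → All (x ≺_) (b ∷ B)) (a ∷ A) → Split w
      descending : ∀ a A b B → w ≡ (a ∷ A) ++ (b ∷ B) → All (λ x → All (_≺ x) (b ∷ B)) (a ∷ A) → Split w

    span : ∀ z A → ∃[ A1 ] ∃[ A2 ] (A ≡ A1 ++ A2 × All (_≺ z) A1 × (A2 ≡ [] ⊎ ∃[ x ] ∃[ A2' ] (A2 ≡ x ∷ A2' × ¬ x ≺ z)))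
    span z [] = [] , [] , refl , [] , inj₁ refl
    span z (x ∷ A) with ≺? x z
    ... | no n = [] , x ∷ A , refl , [] , inj₂ (x , A , refl , n)
    ... | yes p with span z A
    ...   | A1 , A2 , e , h , t = x ∷ A1 , A2 , cong (x ∷_) e , p ∷ h , t

    -- z cuts the first block: the letters before x go below z and all later
    -- letters of the first block above z.  Then A1 | x A2 B z is ascending.
    split-at-cut : ∀ a A b B z x A1 A2 → a ∷ A ≡ A1 ++ x ∷ A2 → ¬ All (z ≺_) (a ∷ A) →
      All (_≺ z) A1 → z ≺ x → All (z ≺_) A2 → All (λ y → All (y ≺_) (b ∷ B)) (A1 ++ x ∷ A2) →
      Split (((a ∷ A) ++ (b ∷ B)) ++ (z ∷ []))
    split-at-cut a A b B z x [] A2 eA nza _ zx zA2 _ = ⊥-elim (nza (subst (All (z ≺_)) (sym eA) (zx ∷ zA2)))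
    split-at-cut a A b B z x (a1 ∷ A1) A2 eA nza h1 zx zA2 crA =
      ascending a1 A1 x (A2 ++ ((b ∷ B) ++ (z ∷ [])))
        (begin
          ((a ∷ A) ++ (b ∷ B)) ++ (z ∷ [])                     ≡⟨ cong (λ L → (L ++ (b ∷ B)) ++ (z ∷ [])) eA ⟩
          (((a1 ∷ A1) ++ x ∷ A2) ++ (b ∷ B)) ++ (z ∷ [])       ≡⟨ ++-assoc ((a1 ∷ A1) ++ x ∷ A2) (b ∷ B) (z ∷ []) ⟩
          ((a1 ∷ A1) ++ x ∷ A2) ++ ((b ∷ B) ++ (z ∷ []))       ≡⟨ ++-assoc (a1 ∷ A1) (x ∷ A2) ((b ∷ B) ++ (z ∷ [])) ⟩
          (a1 ∷ A1) ++ (x ∷ (A2 ++ ((b ∷ B) ++ (z ∷ []))))     ∎)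
        (All.zipWith (λ (yz , yB) → ≺-trans yz zx ∷ ++⁺ (All.map (≺-trans yz) zA2) (++⁺ yB (yz ∷ [])))
                     (h1 , ++⁻ˡ (a1 ∷ A1) crA))
      where open ≡-Reasoning

    extend : ∀ a A b B z → All (λ x → All (x ≺_) (b ∷ B)) (a ∷ A) → All (z ≢_) ((a ∷ A) ++ (b ∷ B)) →
             (∀ x y c → (x ∷ y ∷ c ∷ []) ⊆ ((a ∷ A) ++ (b ∷ B)) → y ≺ z → z ≺ x → x ≺ c → ⊥) →
             Split (((a ∷ A) ++ (b ∷ B)) ++ (z ∷ []))
    extend a A b B z cr nz forbidden with all? (λ x → ≺? x z) (a ∷ A)
    -- z lies above the whole first block: it joins the second block
    ... | yes az = ascending a A b (B ++ z ∷ []) (++-assoc (a ∷ A) (b ∷ B) (z ∷ []))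
                     (All.zipWith (λ (h , xz) → ++⁺ h (xz ∷ [])) (cr , az))
    ... | no naz with all? (λ x → ≺? z x) (a ∷ A)
    -- z lies below the whole first block, hence below everything: a new block
    ...   | yes za@(za₀ ∷ _) = descending a (A ++ b ∷ B) z [] refl
              (++⁺ (All.map (λ zx → zx ∷ []) za) (All.map (λ ax → ≺-trans za₀ ax ∷ []) (All.head cr)))
    ...   | no nza with span z (a ∷ A)
    ...     | A1 , A2 , eA , h1 , inj₁ refl = ⊥-elim (naz (subst (All (_≺ z)) (sym (trans eA (++-identityʳ A1))) h1))
    ...     | A1 , .(x ∷ A2) , eA , h1 , inj₂ (x , A2 , refl , nxz) with all? (λ y → ≺? z y) A2
    ...       | yes zA2 = split-at-cut a A b B z x A1 A2 eA nza h1 zx zA2 crA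
      where
      crA : All (λ y → All (y ≺_) (b ∷ B)) (A1 ++ x ∷ A2)
      crA = subst (All (λ y → All (y ≺_) (b ∷ B))) eA cr
      zx : z ≺ x
      zx = ≺-connex (≢-sym (All.head (++⁻ʳ A1 (subst (All (z ≢_)) eA (++⁻ˡ (a ∷ A) nz))))) nxz
    -- some later letter y of the first block lies below z: x y b forms the
    -- forbidden pattern
    ...       | no nzA2 with find (¬All⇒Any¬ (λ y → ≺? z y) A2 nzA2)
    ...         | y , y∈A2 , nzy = ⊥-elim (forbidden x y b sub (≺-connex z≢y nzy) zx xb)
      where
      nzA : All (z ≢_) (A1 ++ x ∷ A2)
      nzA = subst (All (z ≢_)) eA (++⁻ˡ (a ∷ A) nz)
      zx : z ≺ x
      zx = ≺-connex (λ e → All.head (++⁻ʳ A1 nzA) (sym e)) nxz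
      z≢y : z ≢ y
      z≢y = All.lookup (All.tail (++⁻ʳ A1 nzA)) y∈A2
      xb : x ≺ b
      xb = All.head (All.head (++⁻ʳ A1 (subst (All (λ y → All (y ≺_) (b ∷ B))) eA cr)))
      sub : (x ∷ y ∷ b ∷ []) ⊆ ((a ∷ A) ++ (b ∷ B))
      sub = subst ((x ∷ y ∷ b ∷ []) ⊆_) (sym (trans (cong (_++ (b ∷ B)) eA) (++-assoc A1 (x ∷ A2) (b ∷ B))))
              (++⁺ˡ A1 (refl ∷ Sublist.++⁺ (from∈ y∈A2) (refl ∷ minimum B)))

  triangle : ∀ {x y} → x ≢ y → ¬ x < y → y < x
  triangle ne n = ≤∧≢⇒< (≮⇒≥ n) (λ e → ne (sym e))

  module Lt = Splitting _<_ _<?_ <-trans triangle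
  module Gt = Splitting (λ x y → y < x) (λ x y → y <? x) (λ p q → <-trans q p) (λ ne n → triangle (λ e → ne (sym e)) n)

  fromGt : ∀ {w} → Gt.Split w → Lt.Split w
  fromGt (Gt.ascending a A b B e cr) = Lt.descending a A b B e cr
  fromGt (Gt.descending a A b B e cr) = Lt.ascending a A b B e cr

  split : ∀ n w → length w ≡ suc (suc n) → Avoids w → Unique w → Lt.Split w
  split zero (x ∷ z ∷ []) refl av ((u ∷ []) ∷ _) with <-cmp x z
  ... | tri< xz _ _ = Lt.ascending x [] z [] refl ((xz ∷ []) ∷ [])
  ... | tri≈ _ e _ = ⊥-elim (u e)
  ... | tri> _ _ zx = Lt.descending x [] z [] refl ((zx ∷ []) ∷ [])
  split (suc n) w len av u with initLast w
  ... | w' ∷ʳ′ z with split n w' lenw' (avoids-⊆ (++⁺ʳ (z ∷ []) ⊆-refl) av) (allPairs-⊆ (++⁺ʳ (z ∷ []) ⊆-refl) u)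
    where
    lenw' : length w' ≡ suc (suc n)
    lenw' = suc-injective (trans (trans (+-comm 1 (length w')) (sym (length-++ w'))) len)
  ...   | Lt.ascending a A b B refl cr = Lt.extend a A b B z cr (unique-last _ z u)
            (λ x y c sb yz zx xc → proj₁ (av x y c z (Sublist.++⁺ sb (refl ∷ []))) (yz , zx , xc))
  ...   | Lt.descending a A b B refl cr = fromGt (Gt.extend a A b B z cr (unique-last _ z u)
            (λ x y c sb zy xz cx → proj₂ (av x y c z (Sublist.++⁺ sb (refl ∷ []))) (cx , xz , zy)))

  Good : ℕ → List ℕ → Set
  Good n w = length w ≤ n × Avoids w × Unique w

  -- Every such word is separable, by induction on the length bound: both
  -- blocks of a split are shorter and inherit the hypotheses.
  sepWord : ∀ n w → Good n w → SepWord w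
  blocks : ∀ n {a A b B} → Good (suc n) ((a ∷ A) ++ (b ∷ B)) → SepWord (a ∷ A) × SepWord (b ∷ B)

  sepWord _ [] _ = empty
  sepWord _ (x ∷ []) _ = single x
  sepWord zero (x ∷ y ∷ w) (() , _)
  sepWord (suc n) (x ∷ y ∷ w) g@(le , av , u) with split (length w) (x ∷ y ∷ w) refl av u
  ... | Lt.ascending a A b B e cr with blocks n (subst (Good (suc n)) e g)
  ...   | sA , sB = subst SepWord (sym e) (directSum cr sA sB)
  sepWord (suc n) (x ∷ y ∷ w) g | Lt.descending a A b B e cr with blocks n (subst (Good (suc n)) e g)
  ...   | sA , sB = subst SepWord (sym e) (skewSum cr sA sB)

  blocks n {a} {A} {b} {B} (le , av , u) =
    sepWord n (a ∷ A) (leA , avoids-⊆ prefix av , allPairs-⊆ prefix u) ,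
    sepWord n (b ∷ B) (leB , avoids-⊆ suffix av , allPairs-⊆ suffix u)
    where
    prefix : (a ∷ A) ⊆ ((a ∷ A) ++ (b ∷ B))
    prefix = ++⁺ʳ (b ∷ B) ⊆-refl
    suffix : (b ∷ B) ⊆ ((a ∷ A) ++ (b ∷ B))
    suffix = ++⁺ˡ (a ∷ A) ⊆-refl
    lsum : length (a ∷ A) + length (b ∷ B) ≤ suc n
    lsum = subst (_≤ suc n) (length-++ (a ∷ A)) le
    leA : length (a ∷ A) ≤ n
    leA = ≤-trans (m≤m+n (length (a ∷ A)) (length B)) (≤-pred (subst (_≤ suc n) (+-suc (length (a ∷ A)) (length B)) lsum))
    leB : length (b ∷ B) ≤ n
    leB = ≤-trans (m≤n+m (suc (length B)) (length A)) (≤-pred lsum)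
-- Subsequences of a word as Boolean masks (a missing tail of a mask counts
-- as unselected).
module Masks where

  open import Data.Nat
  open import Data.Nat.Properties
  open import Data.Bool using (Bool; true; false)
  open import Data.List using (List; []; _∷_; _++_; length; take; drop; replicate)
  open import Data.List.Relation.Unary.All using (All; []; _∷_)
  open import Data.List.Relation.Unary.All.Properties using (++⁻ˡ; ++⁻ʳ)
  open import Data.List.Relation.Unary.AllPairs using (AllPairs; []; _∷_)
  open import Data.Product using (_×_; _,_)
  open import Data.Unit using (⊤; tt)
  open import Data.Empty using (⊥)
  open import Relation.Binary.PropositionalEquality

  select : List ℕ → List Bool → List ℕ
  select [] _ = []
  select (x ∷ w) [] = []
  select (x ∷ w) (true ∷ m) = x ∷ select w m
  select (x ∷ w) (false ∷ m) = select w m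

  IncreasingMask : List ℕ → List Bool → Set
  IncreasingMask w m = AllPairs _<_ (select w m)

  DisjointMasks : List Bool → List Bool → Set
  DisjointMasks [] _ = ⊤
  DisjointMasks (_ ∷ _) [] = ⊤
  DisjointMasks (true ∷ m) (true ∷ n) = ⊥
  DisjointMasks (true ∷ m) (false ∷ n) = DisjointMasks m n
  DisjointMasks (false ∷ m) (_ ∷ n) = DisjointMasks m n

  select-nil : ∀ w → select w [] ≡ []
  select-nil [] = refl
  select-nil (x ∷ w) = refl

  select-split : ∀ A B m → select (A ++ B) m ≡ select A (take (length A) m) ++ select B (drop (length A) m)
  select-split [] B m = refl
  select-split (x ∷ A) B [] = sym (select-nil B)
  select-split (x ∷ A) B (true ∷ m) = cong (x ∷_) (select-split A B m)
  select-split (x ∷ A) B (false ∷ m) = select-split A B m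

  select-++ : ∀ A B x y → length x ≡ length A → select (A ++ B) (x ++ y) ≡ select A x ++ select B y
  select-++ [] B [] y _ = refl
  select-++ (a ∷ A) B (true ∷ x) y e = cong (a ∷_) (select-++ A B x y (suc-injective e))
  select-++ (a ∷ A) B (false ∷ x) y e = select-++ A B x y (suc-injective e)

  select-all : ∀ {P : ℕ → Set} w m → All P w → All P (select w m)
  select-all [] m _ = []
  select-all (x ∷ w) [] _ = []
  select-all (x ∷ w) (true ∷ m) (px ∷ pw) = px ∷ select-all w m pw
  select-all (x ∷ w) (false ∷ m) (px ∷ pw) = select-all w m pw

  select-none : ∀ w n → select w (replicate n false) ≡ []
  select-none [] n = refl
  select-none (x ∷ w) zero = refl
  select-none (x ∷ w) (suc n) = select-none w n

  allPairs-++⁻ : ∀ {R : ℕ → ℕ → Set} xs {ys} → AllPairs R (xs ++ ys) →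
    AllPairs R xs × AllPairs R ys × All (λ x → All (R x) ys) xs
  allPairs-++⁻ [] p = [] , p , []
  allPairs-++⁻ (x ∷ xs) (px ∷ p) with allPairs-++⁻ xs p
  ... | a , b , c = ++⁻ˡ xs px ∷ a , b , ++⁻ʳ xs px ∷ c

  disjoint-++ : ∀ x y s → DisjointMasks x (take (length x) s) → DisjointMasks y (drop (length x) s) → DisjointMasks (x ++ y) s
  disjoint-++ [] y s _ d = d
  disjoint-++ (b ∷ x) y [] _ _ = tt
  disjoint-++ (true ∷ x) y (true ∷ s) () _
  disjoint-++ (true ∷ x) y (false ∷ s) d1 d2 = disjoint-++ x y s d1 d2
  disjoint-++ (false ∷ x) y (c ∷ s) d1 d2 = disjoint-++ x y s d1 d2

  disjoint-none : ∀ n s → DisjointMasks (replicate n false) s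
  disjoint-none zero s = tt
  disjoint-none (suc n) [] = tt
  disjoint-none (suc n) (c ∷ s) = disjoint-none n s

  disjoint-unselected : ∀ A x s → length x ≤ length A → select A s ≡ [] → DisjointMasks x s
  disjoint-unselected A [] s _ _ = tt
  disjoint-unselected (a ∷ A) (b ∷ x) [] _ _ = tt
  disjoint-unselected (a ∷ A) (b ∷ x) (true ∷ s) _ ()
  disjoint-unselected (a ∷ A) (true ∷ x) (false ∷ s) (s≤s le) e = disjoint-unselected A x s le e
  disjoint-unselected (a ∷ A) (false ∷ x) (false ∷ s) (s≤s le) e = disjoint-unselected A x s le e

module MainInduction where

  open SumShapes using (shapeOf; direct-shape; skew-shape-bound)
  open SeparableWords using (SepWord; empty; single; directSum; skewSum)
  open Masks
  open import Data.Nat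
  open import Data.Nat.Properties
  open import Data.Bool using (Bool; true; false)
  open import Data.List using (List; []; _∷_; _++_; length; map; take; drop; replicate)
  open import Data.List.Properties using (length-++; length-map; ++-identityʳ; length-replicate)
  open import Data.List.Extrema.Nat using (max; ⊥≤max; xs≤max; max<v⁺)
  open import Data.List.Relation.Unary.All as All using (All; []; _∷_)
  open import Data.List.Relation.Unary.All.Properties using (map⁺; map⁻)
  open import Data.List.Relation.Unary.AllPairs using (AllPairs; []; _∷_)
  import Data.List.Relation.Unary.AllPairs.Properties as AllPairs
  open import Data.Product using (_×_; _,_; proj₁; proj₂)
  open import Data.Sum using (_⊎_; inj₁; inj₂)
  open import Data.Unit using (tt)
  open import Data.Empty using (⊥-elim)
  open import Relation.Nullary using (yes; no)
  open import Relation.Binary.PropositionalEquality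

  -- An increasing mask on w, disjoint from all masks in ss, of length at least
  -- λ_{|ss|}(w) (the parts of the shape are indexed from 0).
  record Answer (w : List ℕ) (ss : List (List Bool)) : Set where
    constructor mkAnswer
    field
      mask : List Bool
      mask-length : length mask ≡ length w
      increasing : IncreasingMask w mask
      disjoint : All (DisjointMasks mask) ss
      large : part (shapeOf w) (length ss) ≤ length (select w mask)

  threshold : ∀ l L U → All (λ u → All (_< u) (l ∷ L)) U → All (_≤ max l L) (l ∷ L) × All (max l L <_) U
  threshold l L U h = (⊥≤max l L ∷ xs≤max l L) , All.map (λ hu → max<v⁺ (All.head hu) (All.tail hu)) h

  transpose : ∀ {R : ℕ → ℕ → Set} {xs ys} → All (λ x → All (R x) ys) xs → All (λ y → All (λ x → R x y) xs) ys
  transpose h = All.tabulate (λ y∈ys → All.map (λ hx → All.lookup hx y∈ys) h)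

  increasing-split : ∀ A B s → IncreasingMask (A ++ B) s →
    IncreasingMask A (take (length A) s) × IncreasingMask B (drop (length A) s)
  increasing-split A B s inc with allPairs-++⁻ (select A (take (length A) s)) (subst (AllPairs _<_) (select-split A B s) inc)
  ... | a , b , _ = a , b

  length-combine : ∀ (A B : List ℕ) (uA uB : List Bool) → length uA ≡ length A → length uB ≡ length B → length (uA ++ uB) ≡ length (A ++ B)
  length-combine A B uA uB lA lB = trans (length-++ uA) (trans (cong₂ _+_ lA lB) (sym (length-++ A)))

  disjoint-combine : ∀ (A : List ℕ) uA uB s → length uA ≡ length A →
    DisjointMasks uA (take (length A) s) → DisjointMasks uB (drop (length A) s) → DisjointMasks (uA ++ uB) s
  disjoint-combine A uA uB s lA d1 d2 =
    disjoint-++ uA uB s (subst (λ z → DisjointMasks uA (take z s)) (sym lA) d1) (subst (λ z → DisjointMasks uB (drop z s)) (sym lA) d2)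

  direct-step : ∀ {m} A B → All (_≤ m) A → All (m <_) B → All (λ x → All (x <_) B) A → ∀ ss →
    Answer A (map (take (length A)) ss) → Answer B (map (drop (length A)) ss) → Answer (A ++ B) ss
  direct-step A B am bm cr ss (mkAnswer uA lA iA dA cA) (mkAnswer uB lB iB dB cB) =
    mkAnswer (uA ++ uB) (length-combine A B uA uB lA lB) increasing disjoint large
    where
    selected : select (A ++ B) (uA ++ uB) ≡ select A uA ++ select B uB
    selected = select-++ A B uA uB lA
    increasing : IncreasingMask (A ++ B) (uA ++ uB)
    increasing = subst (AllPairs _<_) (sym selected)
                   (AllPairs.++⁺ iA iB (All.map (λ h → select-all B uB h) (select-all A uA cr)))
    disjoint : All (DisjointMasks (uA ++ uB)) ss
    disjoint = All.zipWith (λ {s} (d1 , d2) → disjoint-combine A uA uB s lA d1 d2) (map⁻ dA , map⁻ dB)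
    large : part (shapeOf (A ++ B)) (length ss) ≤ length (select (A ++ B) (uA ++ uB))
    large = begin
      part (shapeOf (A ++ B)) (length ss)                          ≡⟨ direct-shape A B am bm (length ss) ⟩
      part (shapeOf A) (length ss) + part (shapeOf B) (length ss)  ≤⟨ +-mono-≤ (subst (λ z → part (shapeOf A) z ≤ _) (length-map _ ss) cA)
                                                                                 (subst (λ z → part (shapeOf B) z ≤ _) (length-map _ ss) cB) ⟩
      length (select A uA) + length (select B uB)                  ≡⟨ sym (length-++ (select A uA)) ⟩
      length (select A uA ++ select B uB)                          ≡⟨ cong length (sym selected) ⟩
      length (select (A ++ B) (uA ++ uB))                          ∎
      where open ≤-Reasoning

  skew-mask-side : ∀ A B s → All (λ a → All (_< a) B) A → IncreasingMask (A ++ B) s →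
    select B (drop (length A) s) ≡ [] ⊎ select A (take (length A) s) ≡ []
  skew-mask-side A B s cr inc with select A (take (length A) s) in ex | select B (drop (length A) s) in ey
  ... | [] | _ = inj₂ refl
  ... | _ ∷ _ | [] = inj₁ refl
  ... | x ∷ X | y ∷ Y with allPairs-++⁻ (x ∷ X) {y ∷ Y} (subst (AllPairs _<_) (trans (select-split A B s) (cong₂ _++_ ex ey)) inc)
  ...   | _ , _ , ((x<y ∷ _) ∷ _) with subst (All (λ a → All (_< a) B)) ex (select-all A (take (length A) s) cr)
  ...     | hx ∷ _ with subst (All (_< x)) ey (select-all B (drop (length A) s) hx)
  ...       | y<x ∷ _ = ⊥-elim (<-asym x<y y<x)

  -- The masks of a skew sum, sorted by the block they live in.  A mask on one
  -- block avoiding the masks sorted into that block avoids all of them there.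
  record MaskPartition (A B : List ℕ) (ss : List (List Bool)) : Set where
    field
      ssA ssB : List (List Bool)
      counts : length ssA + length ssB ≡ length ss
      incA : All (IncreasingMask A) ssA
      incB : All (IncreasingMask B) ssB
      coverA : ∀ uA → length uA ≡ length A → All (DisjointMasks uA) ssA → All (λ s → DisjointMasks uA (take (length A) s)) ss
      coverB : ∀ uB → length uB ≡ length B → All (DisjointMasks uB) ssB → All (λ s → DisjointMasks uB (drop (length A) s)) ss
  open MaskPartition

  partitionMasks : ∀ A B ss → All (λ a → All (_< a) B) A → All (IncreasingMask (A ++ B)) ss → MaskPartition A B ss
  partitionMasks A B [] cr _ = record
    { ssA = [] ; ssB = [] ; counts = refl ; incA = [] ; incB = [] ; coverA = λ _ _ _ → [] ; coverB = λ _ _ _ → [] }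
  partitionMasks A B (s ∷ ss) cr (inc ∷ incs) with partitionMasks A B ss cr incs | skew-mask-side A B s cr inc
  ... | R | inj₁ noneInB = record
    { ssA = take (length A) s ∷ ssA R ; ssB = ssB R ; counts = cong suc (counts R)
    ; incA = proj₁ (increasing-split A B s inc) ∷ incA R ; incB = incB R
    ; coverA = λ { uA l (d ∷ ds) → d ∷ coverA R uA l ds }
    ; coverB = λ uB l ds → disjoint-unselected B uB _ (≤-reflexive l) noneInB ∷ coverB R uB l ds }
  ... | R | inj₂ noneInA = record
    { ssA = ssA R ; ssB = drop (length A) s ∷ ssB R ; counts = trans (+-suc _ _) (cong suc (counts R))
    ; incA = incA R ; incB = proj₂ (increasing-split A B s inc) ∷ incB R
    ; coverA = λ uA l ds → disjoint-unselected A uA _ (≤-reflexive l) noneInA ∷ coverA R uA l ds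
    ; coverB = λ { uB l (d ∷ ds) → d ∷ coverB R uB l ds } }

  skew-bound : ∀ {m} A B → All (m <_) A → All (_≤ m) B → ∀ ss (R : MaskPartition A B ss) →
    part (shapeOf (A ++ B)) (length ss) ≤ part (shapeOf A) (length (ssA R)) ⊔ part (shapeOf B) (length (ssB R))
  skew-bound A B am bm ss R = subst (λ z → part (shapeOf (A ++ B)) z ≤ _) (counts R) (skew-shape-bound A B am bm _ _)

  skew-step : ∀ {m} A B → All (m <_) A → All (_≤ m) B → ∀ ss → (R : MaskPartition A B ss) →
    Answer A (ssA R) → Answer B (ssB R) → Answer (A ++ B) ss
  skew-step A B am bm ss R (mkAnswer uA lA iA dA cA) (mkAnswer uB lB iB dB cB)
    with part (shapeOf B) (length (ssB R)) ≤? part (shapeOf A) (length (ssA R))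
  ... | yes B≤A = mkAnswer (uA ++ replicate (length B) false) (length-combine A B uA (replicate (length B) false) lA (length-replicate (length B)))
                    (subst (AllPairs _<_) (sym selected) iA)
                    (All.map (λ {s} d → disjoint-combine A uA (replicate (length B) false) s lA d (disjoint-none (length B) (drop (length A) s))) (coverA R uA lA dA))
                    (subst (part (shapeOf (A ++ B)) (length ss) ≤_) (sym (cong length selected))
                       (≤-trans (skew-bound A B am bm ss R) (subst (_≤ length (select A uA)) (sym (m≥n⇒m⊔n≡m B≤A)) cA)))
    where
    selected : select (A ++ B) (uA ++ replicate (length B) false) ≡ select A uA
    selected = trans (select-++ A B uA (replicate (length B) false) lA) (trans (cong (select A uA ++_) (select-none B (length B))) (++-identityʳ _))
  ... | no B≰A = mkAnswer (replicate (length A) false ++ uB) (length-combine A B (replicate (length A) false) uB (length-replicate (length A)) lB)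
                    (subst (AllPairs _<_) (sym selected) iB)
                    (All.map (λ {s} d → disjoint-combine A (replicate (length A) false) uB s (length-replicate (length A))
                                                 (disjoint-none (length A) (take (length A) s)) d)
                             (coverB R uB lB dB))
                    (subst (part (shapeOf (A ++ B)) (length ss) ≤_) (sym (cong length selected))
                       (≤-trans (skew-bound A B am bm ss R) (subst (_≤ length (select B uB)) (sym (m≤n⇒m⊔n≡n (<⇒≤ (≰⇒> B≰A)))) cB)))
    where
    selected : select (A ++ B) (replicate (length A) false ++ uB) ≡ select B uB
    selected = trans (select-++ A B (replicate (length A) false) uB (length-replicate (length A))) (cong (_++ select B uB) (select-none A (length A)))

  separable-answer : ∀ {w} → SepWord w → ∀ ss → All (IncreasingMask w) ss → Answer w ss
  separable-answer empty ss _ = mkAnswer [] refl [] (All.universal (λ _ → tt) ss) z≤n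
  separable-answer (single x) [] _ = mkAnswer (true ∷ []) refl ([] ∷ []) [] ≤-refl
  separable-answer (single x) (s ∷ ss) _ = mkAnswer (false ∷ []) refl [] (All.universal (disjoint-none 1) (s ∷ ss)) z≤n
  separable-answer (directSum {a} {A} {b} {B} cr sA sB) ss incs =
    direct-step (a ∷ A) (b ∷ B) (proj₁ sep) (proj₂ sep) cr ss
      (separable-answer sA (map (take (length (a ∷ A))) ss) (map⁺ (All.map (λ {s} i → proj₁ (increasing-split (a ∷ A) (b ∷ B) s i)) incs)))
      (separable-answer sB (map (drop (length (a ∷ A))) ss) (map⁺ (All.map (λ {s} i → proj₂ (increasing-split (a ∷ A) (b ∷ B) s i)) incs)))
    where
    sep : All (_≤ max a A) (a ∷ A) × All (max a A <_) (b ∷ B)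
    sep = threshold a A (b ∷ B) (transpose cr)
  separable-answer (skewSum {a} {A} {b} {B} cr sA sB) ss incs =
    skew-step (a ∷ A) (b ∷ B) (proj₂ sep) (proj₁ sep) ss R (separable-answer sA (ssA R) (incA R)) (separable-answer sB (ssB R) (incB R))
    where
    R : MaskPartition (a ∷ A) (b ∷ B) ss
    R = partitionMasks (a ∷ A) (b ∷ B) ss cr incs
    sep : All (_≤ max b B) (b ∷ B) × All (max b B <_) (a ∷ A)
    sep = threshold b B (a ∷ A) cr

module Transfer where

  open SeparableWords using (SepWord; Avoids; sepWord)
  open Masks
  open MainInduction using (Answer; mkAnswer)
  open import Data.Nat as ℕ using (ℕ; zero; suc; _≤_; _<_; z≤n; s≤s)
  open import Data.Nat.Properties using (<-trans; <-asym; <-irrefl; ≤-trans; ≤-refl)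
  open import Data.Fin as Fin using (Fin; zero; suc; toℕ)
  import Data.Fin.Properties as Fin
  open import Data.Fin.Subset using (Subset; ∣_∣)
  open import Data.Bool using (Bool; true; false)
  open import Data.Vec as Vec using (Vec; []; _∷_; toList; fromList)
  open import Data.Vec.Properties using (lookup⇒[]=; []=⇒lookup; toList∘fromList)
  open import Data.List as List using (List; []; _∷_; length)
  open import Data.List.Properties using (length-tabulate)
  open import Data.List.Relation.Unary.All as All using (All; []; _∷_)
  open import Data.List.Relation.Unary.All.Properties using (tabulate⁺; tabulate⁻)
  open import Data.List.Relation.Unary.AllPairs using (AllPairs; []; _∷_)
  open import Data.List.Relation.Unary.Unique.Propositional {A = ℕ} using (Unique)
  open import Data.List.Relation.Binary.Sublist.Propositional using (_⊆_; []; _∷_; _∷ʳ_)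
  open import Data.Product using (_×_; _,_; Σ; ∃-syntax)
  open import Data.Empty using (⊥; ⊥-elim)
  open import Relation.Binary using (tri<; tri≈; tri>)
  open import Relation.Binary.PropositionalEquality
  open import Function.Definitions using (Injective)

  word : ∀ {n} → (Fin n → Fin n) → List ℕ
  word σ = List.tabulate (λ i → toℕ (σ i))

  sublist-positions : ∀ {n} (g : Fin n → ℕ) xs → xs ⊆ List.tabulate g →
    Σ (Fin (length xs) → Fin n) λ h → (∀ a b → toℕ a < toℕ b → toℕ (h a) < toℕ (h b)) × (∀ a → g (h a) ≡ List.lookup xs a)
  sublist-positions {zero} g [] [] = (λ ()) , (λ ()) , (λ ())
  sublist-positions {suc n} g xs (_ ∷ʳ s) with sublist-positions (λ i → g (suc i)) xs s
  ... | h , inc , val = (λ a → suc (h a)) , (λ a b lt → s≤s (inc a b lt)) , val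
  sublist-positions {suc n} g (x ∷ xs) (refl ∷ s) with sublist-positions (λ i → g (suc i)) xs s
  ... | h , inc , val = h' , inc' , val'
    where
    h' : Fin (suc (length xs)) → Fin (suc n)
    h' zero = zero
    h' (suc a) = suc (h a)
    inc' : ∀ a b → toℕ a < toℕ b → toℕ (h' a) < toℕ (h' b)
    inc' zero (suc b) _ = s≤s z≤n
    inc' (suc a) (suc b) (s≤s lt) = s≤s (inc a b lt)
    val' : ∀ a → g (h' a) ≡ List.lookup (x ∷ xs) a
    val' zero = refl
    val' (suc a) = val a

  allPairs-lookup : ∀ {xs : List ℕ} → AllPairs _<_ xs → ∀ i j → toℕ i < toℕ j → List.lookup xs i < List.lookup xs j
  allPairs-lookup (px ∷ _) zero (suc j) _ = lookup-all px j
    where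
    lookup-all : ∀ {x} {ys : List ℕ} → All (x <_) ys → ∀ j → x < List.lookup ys j
    lookup-all (p ∷ _) zero = p
    lookup-all (_ ∷ ps) (suc j) = lookup-all ps j
  allPairs-lookup (_ ∷ p) (suc i) (suc j) (s≤s lt) = allPairs-lookup p i j lt

  chain : ∀ {v0 v1 v2 v3 : ℕ} → v0 < v1 → v1 < v2 → v2 < v3 → AllPairs _<_ (v0 ∷ v1 ∷ v2 ∷ v3 ∷ [])
  chain p01 p12 p23 =
    (p01 ∷ <-trans p01 p12 ∷ <-trans (<-trans p01 p12) p23 ∷ []) ∷ (p12 ∷ <-trans p12 p23 ∷ []) ∷ (p23 ∷ []) ∷ [] ∷ []

  module _ {n} (σ : Fin n → Fin n) where

    contains : ∀ (π : Fin 4 → Fin 4) (V : Fin 4 → ℕ) → (∀ r r' → toℕ r < toℕ r' → V r < V r') →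
      (h : Fin 4 → Fin n) → (∀ a b → toℕ a < toℕ b → toℕ (h a) < toℕ (h b)) →
      (∀ x → toℕ (σ (h x)) ≡ V (π x)) → Contains σ π
    contains π V mono h inc value = h , inc , λ a b → forward a b , backward a b
      where
      forward : ∀ a b → π a Fin.< π b → σ (h a) Fin.< σ (h b)
      forward a b lt = subst₂ _<_ (sym (value a)) (sym (value b)) (mono (π a) (π b) lt)
      backward : ∀ a b → σ (h a) Fin.< σ (h b) → π a Fin.< π b
      backward a b lt with Fin.<-cmp (π a) (π b)
      ... | tri< p _ _ = p
      ... | tri≈ _ e _ = ⊥-elim (<-irrefl (trans (value a) (trans (cong V e) (sym (value b)))) lt)
      ... | tri> _ _ p = ⊥-elim (<-asym lt (subst₂ _<_ (sym (value b)) (sym (value a)) (mono (π b) (π a) p)))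

    word-avoids : Separable σ → Avoids (word σ)
    word-avoids (no3142 , no2413) a b c d sub with sublist-positions (λ i → toℕ (σ i)) (a ∷ b ∷ c ∷ d ∷ []) sub
    ... | h , inc , val =
        (λ { (bd , da , ac) → no3142 (contains p3142 (List.lookup (b ∷ d ∷ a ∷ c ∷ [])) (allPairs-lookup (chain bd da ac)) h inc v3142) })
      , (λ { (ca , ad , db) → no2413 (contains p2413 (List.lookup (c ∷ a ∷ d ∷ b ∷ [])) (allPairs-lookup (chain ca ad db)) h inc v2413) })
      where
      v3142 : ∀ x → toℕ (σ (h x)) ≡ List.lookup (b ∷ d ∷ a ∷ c ∷ []) (p3142 x)
      v3142 zero = val zero
      v3142 (suc zero) = val (suc zero)
      v3142 (suc (suc zero)) = val (suc (suc zero))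
      v3142 (suc (suc (suc zero))) = val (suc (suc (suc zero)))
      v2413 : ∀ x → toℕ (σ (h x)) ≡ List.lookup (c ∷ a ∷ d ∷ b ∷ []) (p2413 x)
      v2413 zero = val zero
      v2413 (suc zero) = val (suc zero)
      v2413 (suc (suc zero)) = val (suc (suc zero))
      v2413 (suc (suc (suc zero))) = val (suc (suc (suc zero)))

    word-unique : Injective _≡_ _≡_ σ → Unique (word σ)
    word-unique inj = go (λ i → toℕ (σ i)) (λ e → inj (Fin.toℕ-injective e))
      where
      go : ∀ {m} (g : Fin m → ℕ) → (∀ {i j} → g i ≡ g j → i ≡ j) → Unique (List.tabulate g)
      go {zero} g g-inj = []
      go {suc m} g g-inj = tabulate⁺ (λ i e → Fin.0≢1+n (g-inj e)) ∷ go (λ i → g (suc i)) (λ e → Fin.suc-injective (g-inj e))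

    word-separable : Injective _≡_ _≡_ σ → Separable σ → SepWord (word σ)
    word-separable inj sep = sepWord (length (word σ)) (word σ) (≤-refl , word-avoids sep , word-unique inj)

  select-members : ∀ {n} {P : ℕ → Set} (g : Fin n → ℕ) (v : Vec Bool n) → (∀ j → Vec.lookup v j ≡ true → P (g j)) →
    All P (select (List.tabulate g) (toList v))
  select-members g [] h = []
  select-members g (true ∷ v) h = h zero refl ∷ select-members (λ i → g (suc i)) v (λ j e → h (suc j) e)
  select-members g (false ∷ v) h = select-members (λ i → g (suc i)) v (λ j e → h (suc j) e)

  member-selected : ∀ {n} {P : ℕ → Set} (g : Fin n → ℕ) (v : Vec Bool n) j → Vec.lookup v j ≡ true →
    All P (select (List.tabulate g) (toList v)) → P (g j)
  member-selected g (true ∷ v) zero e (p ∷ _) = p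
  member-selected g (true ∷ v) (suc j) e (_ ∷ ps) = member-selected (λ i → g (suc i)) v j e ps
  member-selected g (false ∷ v) zero () ps
  member-selected g (false ∷ v) (suc j) e ps = member-selected (λ i → g (suc i)) v j e ps

  subset⇒increasingMask : ∀ {n} (g : Fin n → ℕ) (v : Vec Bool n) →
    (∀ i j → Vec.lookup v i ≡ true → Vec.lookup v j ≡ true → toℕ i < toℕ j → g i < g j) →
    IncreasingMask (List.tabulate g) (toList v)
  subset⇒increasingMask g [] h = []
  subset⇒increasingMask g (true ∷ v) h =
    select-members (λ i → g (suc i)) v (λ j e → h zero (suc j) refl e (s≤s z≤n))
    ∷ subset⇒increasingMask (λ i → g (suc i)) v (λ i j ei ej lt → h (suc i) (suc j) ei ej (s≤s lt))
  subset⇒increasingMask g (false ∷ v) h = subset⇒increasingMask (λ i → g (suc i)) v (λ i j ei ej lt → h (suc i) (suc j) ei ej (s≤s lt))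

  increasingMask⇒subset : ∀ {n} (g : Fin n → ℕ) (v : Vec Bool n) → IncreasingMask (List.tabulate g) (toList v) →
    ∀ i j → Vec.lookup v i ≡ true → Vec.lookup v j ≡ true → toℕ i < toℕ j → g i < g j
  increasingMask⇒subset g (true ∷ v) (p ∷ ap) zero (suc j) ei ej lt = member-selected (λ i → g (suc i)) v j ej p
  increasingMask⇒subset g (true ∷ v) (p ∷ ap) (suc i) (suc j) ei ej (s≤s lt) = increasingMask⇒subset (λ i → g (suc i)) v ap i j ei ej lt
  increasingMask⇒subset g (false ∷ v) ap zero j () ej lt
  increasingMask⇒subset g (false ∷ v) ap (suc i) zero ei () lt
  increasingMask⇒subset g (false ∷ v) ap (suc i) (suc j) ei ej (s≤s lt) = increasingMask⇒subset (λ i → g (suc i)) v ap i j ei ej lt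

  disjointMasks⇒disjoint : ∀ {n} (u s : Vec Bool n) → DisjointMasks (toList u) (toList s) →
    ∀ x → Vec.lookup u x ≡ true → Vec.lookup s x ≡ true → ⊥
  disjointMasks⇒disjoint (true ∷ u) (true ∷ s) () x eu es
  disjointMasks⇒disjoint (true ∷ u) (false ∷ s) d zero eu ()
  disjointMasks⇒disjoint (true ∷ u) (false ∷ s) d (suc x) eu es = disjointMasks⇒disjoint u s d x eu es
  disjointMasks⇒disjoint (false ∷ u) (c ∷ s) d zero () es
  disjointMasks⇒disjoint (false ∷ u) (c ∷ s) d (suc x) eu es = disjointMasks⇒disjoint u s d x eu es

  select-size : ∀ {n} (g : Fin n → ℕ) (v : Vec Bool n) → length (select (List.tabulate g) (toList v)) ≤ ∣ v ∣
  select-size g [] = z≤n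
  select-size g (true ∷ v) = s≤s (select-size (λ i → g (suc i)) v)
  select-size g (false ∷ v) = select-size (λ i → g (suc i)) v

  vecOfMask : ∀ {n} (m : List Bool) → length m ≡ n → Σ (Vec Bool n) (λ v → toList v ≡ m)
  vecOfMask m refl = fromList m , toList∘fromList m

  module _ {n} (σ : Fin n → Fin n) where

    masksOf : ∀ {k} → (Fin k → Subset n) → List (List Bool)
    masksOf s = List.tabulate (λ i → toList (s i))

    masks-increasing : ∀ {k} (s : Fin k → Subset n) → (∀ i → Increasing σ (s i)) → All (IncreasingMask (word σ)) (masksOf s)
    masks-increasing s incs = tabulate⁺ (λ i → subset⇒increasingMask (λ j → toℕ (σ j)) (s i)
      (λ a b ea eb lt → incs i a b (lookup⇒[]= a (s i) ea) (lookup⇒[]= b (s i) eb) lt))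

    subset-from-answer : ∀ {k} (s : Fin k → Subset n) → Answer (word σ) (masksOf s) →
      ∃[ u ] (Increasing σ u × (∀ i → Disjoint u (s i)) × part (shape σ) k ≤ ∣ u ∣)
    subset-from-answer {k} s (mkAnswer mask lenU inc disj large) with vecOfMask mask (trans lenU (length-tabulate (λ j → toℕ (σ j))))
    ... | u , refl = u , increasing , disjoint , bound
      where
      increasing : Increasing σ u
      increasing a b ea eb lt = increasingMask⇒subset (λ j → toℕ (σ j)) u inc a b ([]=⇒lookup ea) ([]=⇒lookup eb) lt
      disjoint : ∀ i → Disjoint u (s i)
      disjoint i x ex es = disjointMasks⇒disjoint u (s i) (tabulate⁻ disj i) x ([]=⇒lookup ex) ([]=⇒lookup es)
      bound : part (shape σ) k ≤ ∣ u ∣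
      bound = ≤-trans (subst (λ z → part (shape σ) z ≤ length (select (word σ) (toList u))) (length-tabulate _) large)
                      (select-size (λ j → toℕ (σ j)) u)

-- Proposition 2.4.  The word of σ is separable; the main induction applied to
-- the masks of s¹, …, sᵏ yields the required subsequence.
proposition2p4 : ∀ {n} (σ : Fin n → Fin n) → Injective _≡_ _≡_ σ → Separable σ → (k : ℕ) (s : Fin k → Subset n) → (∀ i → Increasing σ (s i)) → (∀ i j → i ≢ j → Disjoint (s i) (s j)) → ∃[ u ] (Increasing σ u × (∀ i → Disjoint u (s i)) × part (shape σ) k ≤ ∣ u ∣)
proposition2p4 σ inj sep k s incs _ =
  subset-from-answer σ s (separable-answer (word-separable σ inj sep) (masksOf σ s) (masks-increasing σ s incs))
  where
  open Transfer
  open MainInduction using (separable-answer)
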